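{- Let $q$ be an integral power of an odd prime. Then $$\lim_{n\to\infty}\frac{\sum_{f\in\mathcal{Y}_n(\mathbb{F}_q)}\big(X_1(f)+Y_1(f)\big)}{|\mathcal{Y}_n(\mathbb{F}_q)|}=\frac{q-1}{q+1};$$ that is, the expected number of linear factors of a uniformly random $f\in\mathcal{Y}_n(\mathbb{F}_q)$ converges to $\frac{q-1}{q+1}$.
   Context: $\mathcal{Y}_n(\mathbb{F}_q)$ is the set of monic squarefree degree-$n$ polynomials $f\in\mathbb{F}_q[T]$ with $f(0)\ne0$. For such $f$, $X_1(f)$ is the number of linear factors $T-a$ of $f$ with $a$ a square in $\mathbb{F}_q$, and $Y_1(f)$ the number of linear factors $T-a$ with $a$ a nonsquare in $\mathbb{F}_q$, so $X_1(f)+Y_1(f)$ is the number of linear factors of $f$. -}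

module Defs where

open import Level using (0ℓ)
open import Data.Bool using (Bool; true; false; not; _∧_; if_then_else_)
open import Data.Nat using (ℕ; zero; suc; _+_; _∸_; _≤ᵇ_)
open import Data.List using (List; []; _∷_; [_]; _++_; map; concatMap; filterᵇ; length; upTo)
open import Data.Bool.ListAction using (any)
open import Data.Nat.ListAction using (sum)
open import Data.List.Properties using (≡-dec)
open import Data.List.Membership.Propositional using (_∈_)
open import Data.List.Relation.Unary.Unique.Propositional using (Unique)
open import Data.Vec using (Vec; toList)
open import Data.Product using (∃)
open import Relation.Nullary using (¬_; does)
open import Relation.Binary.Definitions using (DecidableEquality)
open import Relation.Binary.PropositionalEquality using (_≡_; _≢_)
open import Algebra.Structures using (IsCommutativeRing)

record FiniteField : Set₁ where
  field
    F    : Set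
    _⊕_  : F → F → F
    _⊗_  : F → F → F
    ⊖_   : F → F
    0#   : F
    1#   : F
    isCommutativeRing : IsCommutativeRing _≡_ _⊕_ _⊗_ ⊖_ 0# 1#
    0≢1  : 0# ≢ 1#
    inverse : ∀ x → x ≢ 0# → ∃ λ y → x ⊗ y ≡ 1#
    _≟_  : DecidableEquality F
    elems : List F
    elems-unique : Unique elems
    elems-complete : ∀ x → x ∈ elems

module _ (K : FiniteField) where
  open FiniteField K

  order : ℕ
  order = length elems

  -- Polynomials as coefficient lists, lowest degree first.
  Poly : Set
  Poly = List F

  addP : Poly → Poly → Poly
  addP [] g = g
  addP (a ∷ f) [] = a ∷ f
  addP (a ∷ f) (b ∷ g) = (a ⊕ b) ∷ addP f g

  mulP : Poly → Poly → Poly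
  mulP [] g = []
  mulP (a ∷ f) g = addP (map (a ⊗_) g) (0# ∷ mulP f g)

  _==_ : Poly → Poly → Bool
  f == g = does (≡-dec _≟_ f g)

  -- A monic polynomial of degree n is T^n + c_{n-1} T^{n-1} + ... + c_0,
  -- represented by the vector (c_0, ..., c_{n-1}).
  monic : ∀ {n} → Vec F n → Poly
  monic c = toList c ++ [ 1# ]

  allMonic : (n : ℕ) → List (Vec F n)
  allMonic zero = Vec.[] ∷ []
  allMonic (suc n) = concatMap (λ x → map (x Vec.∷_) (allMonic n)) elems

  dividesWith : Poly → (k : ℕ) → Poly → Bool
  dividesWith g k f = any (λ h → mulP g (monic h) == f) (allMonic k)

  squarefree : ∀ {n} → Vec F n → Bool
  squarefree {n} f =
    not (any (λ d → ((d + d) ≤ᵇ n) ∧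
                    any (λ g → dividesWith (mulP (monic g) (monic g)) (n ∸ (d + d)) (monic f))
                        (allMonic d))
             (map suc (upTo n)))

  const0 : ∀ {n} → Vec F n → F
  const0 f with monic f
  ... | [] = 1#
  ... | a ∷ _ = a

  nonzeroConst : ∀ {n} → Vec F n → Bool
  nonzeroConst f = not (does (const0 f ≟ 0#))

  𝒴 : (n : ℕ) → List (Vec F n)
  𝒴 n = filterᵇ (λ f → squarefree f ∧ nonzeroConst f) (allMonic n)

  isSquare : F → Bool
  isSquare a = any (λ b → does ((b ⊗ b) ≟ a)) elems

  linearDivides : ∀ {n} → F → Vec F n → Bool
  linearDivides {n} a f = dividesWith (⊖ a ∷ 1# ∷ []) (n ∸ 1) (monic f)

  X₁ : ∀ {n} → Vec F n → ℕ
  X₁ f = length (filterᵇ (λ a → isSquare a ∧ linearDivides a f) elems)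

  Y₁ : ∀ {n} → Vec F n → ℕ
  Y₁ f = length (filterᵇ (λ a → not (isSquare a) ∧ linearDivides a f) elems)

  totalLinear : ℕ → ℕ
  totalLinear n = sum (map (λ f → X₁ f + Y₁ f) (𝒴 n))

  card𝒴 : ℕ → ℕ
  card𝒴 n = length (𝒴 n)

module Submission where

-- Write S(n), A(n) = |𝒴_n| for the numbers of squarefree monic polynomials of
-- degree n without, resp. with, the condition f(0) ≠ 0, and B(n) for those f ∈ 𝒴_n
-- with moreover f(1) ≠ 0.  The proof is a counting argument in three stages.
--  1. Algebra of K[T] (module Polynomials): polynomials as coefficient lists up to
--     trailing zeros form a commutative ring; monic polynomials can be cancelled and
--     divided by; the Euclidean algorithm gives Bézout identities, hence Gauss' lemma
--     and uniqueness of the decomposition f = g² h with h squarefree; evaluation and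
--     the factor theorem describe when (T - c) · g is squarefree.
--  2. Counting (module Counting): unique square decomposition gives
--     S(n+2) + q^{n+1} = q^{n+2}; multiplying by T - c bijects squarefree g with
--     g(c) ≠ 0 onto squarefree f with f(c) = 0, which gives A(m+1) + A(m) = S(m+1)
--     and B(m+1) + B(m) = A(m+1); double counting gives the total number of linear
--     factors T(m+1) = (q-1) · B(m).
--  3. Asymptotics (modules LinearVsExponential, Asymptotics, RationalBound): solving
--     these recurrences over ℤ gives (q+1) T(m+1) - (q-1) A(m+1) = ±(q-1)(q m - m - 2)
--     and (q+1) A(m+1) = (q-1)(q^{m+1} ∓ 1), so T/A - (q-1)/(q+1) = O(m / q^m); this
--     estimate is then converted into a statement about rationals.

open import Defs using (FiniteField; module FiniteField; addP; mulP)
import Defs as D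
import Data.Nat as Nt
open Nt using (ℕ; zero; suc; _≤_; z≤n; s≤s)
import Data.Nat.Properties as NP
import Data.Bool.Properties as BP
open import Data.Bool using (Bool; true; false; not; _∧_; if_then_else_)
import Function.Bundles
open import Data.List using (List; []; _∷_; map; length; _++_; [_]; concatMap; filterᵇ; upTo; downFrom)
open import Data.List.Properties using (length-map; length-++; map-cong; ≡-dec; ∷-injectiveˡ; ∷-injectiveʳ)
open import Data.Nat.ListAction using (sum)
open import Data.Bool.ListAction using (any)
open import Data.List.Relation.Unary.Any using (here; there)
open import Data.List.Relation.Unary.All using (All; []; _∷_)
open import Data.List.Relation.Unary.AllPairs using ([]; _∷_)
open import Data.List.Membership.Propositional using (_∈_)
open import Data.List.Membership.Propositional.Properties
  using (∈-∃++; ∈-++⁻; ∈-++⁺ˡ; ∈-++⁺ʳ; ∈-map⁺; ∈-map⁻; ∈-applyUpTo⁺; ∈-applyDownFrom⁺)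
open import Data.List.Relation.Unary.Unique.Propositional using (Unique)
import Data.List.Relation.Unary.Unique.Propositional.Properties as UP
open import Data.Vec using (Vec; toList; zipWith; replicate) renaming ([] to []ᵥ; _∷_ to _∷ᵥ_)
import Data.Vec.Properties as VP
open import Data.Product using (_×_; _,_; proj₁; proj₂; ∃; Σ; Σ-syntax)
open import Data.Sum using (_⊎_; inj₁; inj₂)
open import Data.Unit using (⊤; tt)
open import Data.Empty using (⊥; ⊥-elim)
open import Relation.Nullary using (¬_; yes; no; does)
open import Relation.Binary.PropositionalEquality as Eq using (_≡_; _≢_; refl; cong; cong₂; sym; trans; subst)

-- Finite sets are represented by duplicate-free lists;
-- the cardinality facts used below are: two duplicate-free lists with the same
-- members have the same length, and concatMap / filterᵇ / map interact with
-- length and membership in the expected way.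
module ListCounting where
  open import Data.Nat using (ℕ; zero; suc; _+_; _*_; _≤_; z≤n; s≤s)
  import Data.Nat.Tactic.RingSolver as NS
  import Data.List.Relation.Unary.All as All

  private
    variable
      A B : Set

  Unique-tail : ∀ {x : A} {xs} → Unique (x ∷ xs) → Unique xs
  Unique-tail (_ ∷ u) = u

  remove∈ : ∀ {z x : A} as bs → z ∈ as ++ x ∷ bs → z ≢ x → z ∈ as ++ bs
  remove∈ [] bs (here p) ne = ⊥-elim (ne p)
  remove∈ [] bs (there p) ne = p
  remove∈ (a ∷ as) bs (here p) ne = here p
  remove∈ (a ∷ as) bs (there p) ne = there (remove∈ as bs p ne)

  length-mid : ∀ (as : List A) x bs → length (as ++ x ∷ bs) ≡ suc (length (as ++ bs))
  length-mid [] x bs = refl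
  length-mid (a ∷ as) x bs = cong suc (length-mid as x bs)

  -- A duplicate-free list included in another one is not longer: remove the
  -- head of xs from ys and recurse.
  unique-⊆⇒length≤ : ∀ {xs ys : List A} → Unique xs → (∀ {z} → z ∈ xs → z ∈ ys) → length xs ≤ length ys
  unique-⊆⇒length≤ {xs = []} u sub = z≤n
  unique-⊆⇒length≤ {xs = x ∷ xs} {ys} u sub with ∈-∃++ (sub (here refl))
  ... | as , bs , refl = subst (suc (length xs) ≤_) (sym (length-mid as x bs))
        (s≤s (unique-⊆⇒length≤ (Unique-tail u) λ {z} z∈ →
          remove∈ as bs (sub (there z∈)) λ { refl → UP.Unique[x∷xs]⇒x∉xs u z∈ }))

  unique-≋⇒length≡ : ∀ {xs ys : List A} → Unique xs → Unique ys →
    (∀ {z} → z ∈ xs → z ∈ ys) → (∀ {z} → z ∈ ys → z ∈ xs) → length xs ≡ length ys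
  unique-≋⇒length≡ u v f g = NP.≤-antisym (unique-⊆⇒length≤ u f) (unique-⊆⇒length≤ v g)

  ∈-concatMap⁻ : ∀ (f : A → List B) xs {z} → z ∈ concatMap f xs → Σ[ x ∈ A ] x ∈ xs × z ∈ f x
  ∈-concatMap⁻ f (x ∷ xs) p with ∈-++⁻ (f x) p
  ... | inj₁ q = x , here refl , q
  ... | inj₂ q with ∈-concatMap⁻ f xs q
  ... | y , y∈ , r = y , there y∈ , r

  ∈-concatMap⁺ : ∀ (f : A → List B) {xs x z} → x ∈ xs → z ∈ f x → z ∈ concatMap f xs
  ∈-concatMap⁺ f {x' ∷ xs} (here refl) q = ∈-++⁺ˡ q
  ∈-concatMap⁺ f {x' ∷ xs} (there p) q = ∈-++⁺ʳ (f x') (∈-concatMap⁺ f p q)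

  Unique-++ : ∀ {xs ys : List A} → Unique xs → Unique ys → (∀ {z} → z ∈ xs → z ∈ ys → ⊥) → Unique (xs ++ ys)
  Unique-++ {xs = []} u v disjoint = v
  Unique-++ {xs = x ∷ xs} (x∉ ∷ u) v disjoint =
    All.tabulate (λ y∈ → λ { refl → elsewhere (∈-++⁻ xs y∈) }) ∷ Unique-++ u v (λ p q → disjoint (there p) q)
    where
    elsewhere : x ∈ xs ⊎ x ∈ _ → ⊥
    elsewhere (inj₁ p) = UP.Unique[x∷xs]⇒x∉xs (x∉ ∷ u) p
    elsewhere (inj₂ q) = disjoint (here refl) q

  -- concatMap of pairwise disjoint duplicate-free blocks is duplicate-free;
  -- disjointness is witnessed by recovering the block index from an element.
  Unique-concatMap : ∀ (f : A → List B) {xs} → Unique xs → (∀ x → Unique (f x)) →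
    (∀ {x y z} → z ∈ f x → z ∈ f y → x ≡ y) → Unique (concatMap f xs)
  Unique-concatMap f {[]} u uf tag = []
  Unique-concatMap f {x ∷ xs} u uf tag = Unique-++ (uf x) (Unique-concatMap f (Unique-tail u) uf tag)
    λ p q → let (y , y∈ , r) = ∈-concatMap⁻ f xs q in UP.Unique[x∷xs]⇒x∉xs u (subst (_∈ xs) (sym (tag p r)) y∈)

  length-concatMap : ∀ (f : A → List B) xs → length (concatMap f xs) ≡ sum (map (λ x → length (f x)) xs)
  length-concatMap f [] = refl
  length-concatMap f (x ∷ xs) = trans (length-++ (f x)) (cong (length (f x) +_) (length-concatMap f xs))

  ∈-filterᵇ⁻ : ∀ (p : A → Bool) xs {z} → z ∈ filterᵇ p xs → z ∈ xs × p z ≡ true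
  ∈-filterᵇ⁻ p (x ∷ xs) q with p x in eq
  ∈-filterᵇ⁻ p (x ∷ xs) (here refl) | true = here refl , eq
  ∈-filterᵇ⁻ p (x ∷ xs) (there q) | true = let (a , b) = ∈-filterᵇ⁻ p xs q in there a , b
  ∈-filterᵇ⁻ p (x ∷ xs) q | false = let (a , b) = ∈-filterᵇ⁻ p xs q in there a , b

  ∈-filterᵇ⁺ : ∀ (p : A → Bool) xs {z} → z ∈ xs → p z ≡ true → z ∈ filterᵇ p xs
  ∈-filterᵇ⁺ p (x ∷ xs) (here refl) pz with p x
  ∈-filterᵇ⁺ p (x ∷ xs) (here refl) refl | .true = here refl
  ∈-filterᵇ⁺ p (x ∷ xs) (there q) pz with p x
  ... | true = there (∈-filterᵇ⁺ p xs q pz)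
  ... | false = ∈-filterᵇ⁺ p xs q pz

  Unique-filterᵇ : ∀ (p : A → Bool) {xs} → Unique xs → Unique (filterᵇ p xs)
  Unique-filterᵇ p u = UP.filter⁺ _ u

  filter-split : ∀ (p q : A → Bool) xs →
    length (filterᵇ p xs) ≡ length (filterᵇ (λ x → p x ∧ q x) xs) + length (filterᵇ (λ x → p x ∧ not (q x)) xs)
  filter-split p q [] = refl
  filter-split p q (x ∷ xs) with p x | q x
  ... | true | true = cong suc (filter-split p q xs)
  ... | true | false = trans (cong suc (filter-split p q xs)) (sym (NP.+-suc _ _))
  ... | false | _ = filter-split p q xs

  filter-ext : ∀ (p q : A → Bool) xs → (∀ x → p x ≡ q x) → filterᵇ p xs ≡ filterᵇ q xs
  filter-ext p q [] e = refl
  filter-ext p q (x ∷ xs) e with p x | q x | e x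
  ... | true | .true | refl = cong (x ∷_) (filter-ext p q xs e)
  ... | false | .false | refl = filter-ext p q xs e

  filter-filter : ∀ (p q : A → Bool) xs → filterᵇ p (filterᵇ q xs) ≡ filterᵇ (λ x → q x ∧ p x) xs
  filter-filter p q [] = refl
  filter-filter p q (x ∷ xs) with q x
  ... | false = filter-filter p q xs
  ... | true with p x
  ...   | true = cong (x ∷_) (filter-filter p q xs)
  ...   | false = filter-filter p q xs

  filter-all : ∀ (xs : List A) → filterᵇ (λ _ → true) xs ≡ xs
  filter-all [] = refl
  filter-all (x ∷ xs) = cong (x ∷_) (filter-all xs)

  filter-none : ∀ (p : A → Bool) xs → (∀ x → p x ≡ false) → length (filterᵇ p xs) ≡ 0
  filter-none p [] e = refl
  filter-none p (x ∷ xs) e with p x | e x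
  ... | false | _ = filter-none p xs e

  indicator : Bool → ℕ
  indicator true = 1
  indicator false = 0

  length-filter≡sum : ∀ (p : A → Bool) xs → length (filterᵇ p xs) ≡ sum (map (λ x → indicator (p x)) xs)
  length-filter≡sum p [] = refl
  length-filter≡sum p (x ∷ xs) with p x
  ... | true = cong suc (length-filter≡sum p xs)
  ... | false = length-filter≡sum p xs

  sum-map-+ : ∀ (f g : A → ℕ) xs → sum (map (λ x → f x + g x) xs) ≡ sum (map f xs) + sum (map g xs)
  sum-map-+ f g [] = refl
  sum-map-+ f g (x ∷ xs) = trans (cong (f x + g x +_) (sum-map-+ f g xs)) (interchange (f x) (g x) (sum (map f xs)) (sum (map g xs)))
    where
    interchange : ∀ a b c d → (a + b) + (c + d) ≡ (a + c) + (b + d)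
    interchange = NS.solve-∀

  sum-const : ∀ k (xs : List A) → sum (map (λ _ → k) xs) ≡ length xs * k
  sum-const k [] = refl
  sum-const k (x ∷ xs) = cong (k +_) (sum-const k xs)

  double-count : ∀ (R : A → B → Bool) xs ys →
    sum (map (λ x → length (filterᵇ (R x) ys)) xs) ≡ sum (map (λ y → length (filterᵇ (λ x → R x y) xs)) ys)
  double-count R [] ys = sym (no-rows ys)
    where
    no-rows : ∀ ys → sum (map (λ y → length (filterᵇ (λ x → R x y) [])) ys) ≡ 0
    no-rows [] = refl
    no-rows (y ∷ ys) = no-rows ys
  double-count R (x ∷ xs) ys = trans (cong (length (filterᵇ (R x) ys) +_) (double-count R xs ys))
    (trans (cong (_+ _) (length-filter≡sum (R x) ys)) (trans (sym (sum-map-+ (λ y → indicator (R x y)) _ ys)) (cong sum (add-row ys))))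
    where
    add-row : ∀ ys → map (λ y → indicator (R x y) + length (filterᵇ (λ x' → R x' y) xs)) ys
                   ≡ map (λ y → length (filterᵇ (λ x' → R x' y) (x ∷ xs))) ys
    add-row [] = refl
    add-row (y ∷ ys) with R x y
    ... | true = cong (_ ∷_) (add-row ys)
    ... | false = cong (_ ∷_) (add-row ys)

  any⁻ : ∀ (p : A → Bool) xs → any p xs ≡ true → Σ[ x ∈ A ] x ∈ xs × p x ≡ true
  any⁻ p (x ∷ xs) e with p x in eq
  ... | true = x , here refl , eq
  ... | false = let (y , a , b) = any⁻ p xs e in y , there a , b

  any⁺ : ∀ (p : A → Bool) {xs x} → x ∈ xs → p x ≡ true → any p xs ≡ true
  any⁺ p {x' ∷ xs} (here refl) e rewrite e = refl
  any⁺ p {x' ∷ xs} (there q) e with p x'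
  ... | true = refl
  ... | false = any⁺ p q e

module Polynomials (K : FiniteField) where
  open import Data.Nat using (ℕ; zero; suc; _+_; _*_; _^_; _∸_; _≤_; _<_; z≤n; s≤s; _≤ᵇ_)

  open import Algebra.Bundles using (CommutativeRing)
  open import Relation.Binary.Bundles using (Setoid)
  open import Relation.Binary.Structures using (IsEquivalence)
  import Algebra.Properties.Ring
  import Algebra.Properties.CommutativeSemigroup as CSP
  open Eq.≡-Reasoning
  open FiniteField K public

  fieldRing : CommutativeRing _ _
  fieldRing = record { isCommutativeRing = isCommutativeRing }

  module FieldRing = CommutativeRing fieldRing
  open FieldRing public using (+-comm; +-assoc; *-comm; *-assoc; distribˡ; distribʳ; zeroˡ; zeroʳ;
    +-identityˡ; +-identityʳ; *-identityˡ; *-identityʳ; -‿inverseˡ; -‿inverseʳ)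
  open import Algebra.Properties.Ring (CommutativeRing.ring fieldRing) public using (-‿involutive; -0#≈0#)

  Poly : Set
  Poly = List F

  infixl 6 _+ₚ_
  infixl 7 _*ₚ_
  _+ₚ_ : Poly → Poly → Poly
  _+ₚ_ = addP K
  _*ₚ_ : Poly → Poly → Poly
  _*ₚ_ = mulP K

  -ₚ_ : Poly → Poly
  -ₚ_ = map (⊖_)

  scale : F → Poly → Poly
  scale a = map (a ⊗_)

  IsZero : Poly → Set
  IsZero [] = ⊤
  IsZero (x ∷ xs) = x ≡ 0# × IsZero xs

  -- Equality of polynomials: equal coefficients, where missing ones count as 0.
  infix 4 _≈_
  data _≈_ : Poly → Poly → Set where
    []≈ : ∀ {ys} → IsZero ys → [] ≈ ys
    ≈[] : ∀ {x xs} → IsZero (x ∷ xs) → (x ∷ xs) ≈ []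
    ∷≈ : ∀ {x y xs ys} → x ≡ y → xs ≈ ys → (x ∷ xs) ≈ (y ∷ ys)

  ≈-refl : ∀ {xs} → xs ≈ xs
  ≈-refl {[]} = []≈ tt
  ≈-refl {x ∷ xs} = ∷≈ refl ≈-refl

  zero≈[] : ∀ {xs} → IsZero xs → xs ≈ []
  zero≈[] {[]} z = []≈ tt
  zero≈[] {x ∷ xs} z = ≈[] z

  ≈[]⇒zero : ∀ {xs} → xs ≈ [] → IsZero xs
  ≈[]⇒zero ([]≈ z) = tt
  ≈[]⇒zero (≈[] z) = z

  ≈-sym : ∀ {xs ys} → xs ≈ ys → ys ≈ xs
  ≈-sym ([]≈ z) = zero≈[] z
  ≈-sym (≈[] z) = []≈ z
  ≈-sym (∷≈ p e) = ∷≈ (sym p) (≈-sym e)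

  zero-resp-≈ : ∀ {xs ys} → IsZero xs → xs ≈ ys → IsZero ys
  zero-resp-≈ z ([]≈ z') = z'
  zero-resp-≈ z (≈[] _) = tt
  zero-resp-≈ (x0 , z) (∷≈ p e) = trans (sym p) x0 , zero-resp-≈ z e

  ≈-trans : ∀ {xs ys zs} → xs ≈ ys → ys ≈ zs → xs ≈ zs
  ≈-trans ([]≈ z) e2 = []≈ (zero-resp-≈ z e2)
  ≈-trans (≈[] z) ([]≈ z') = ZZ≈ z z'
    where
    ZZ≈ : ∀ {xs ys} → IsZero xs → IsZero ys → xs ≈ ys
    ZZ≈ {[]} _ z = []≈ z
    ZZ≈ {x ∷ xs} {[]} z _ = ≈[] z
    ZZ≈ {x ∷ xs} {y ∷ ys} (x0 , z) (y0 , z') = ∷≈ (trans x0 (sym y0)) (ZZ≈ z z')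
  ≈-trans (∷≈ p e1) (≈[] (y0 , z)) = ≈[] (trans p y0 , ≈[]⇒zero (≈-trans e1 (zero≈[] z)))
  ≈-trans (∷≈ p e1) (∷≈ q e2) = ∷≈ (trans p q) (≈-trans e1 e2)

  ≡⇒≈ : ∀ {xs ys} → xs ≡ ys → xs ≈ ys
  ≡⇒≈ refl = ≈-refl

  ≈-isEquivalence : IsEquivalence _≈_
  ≈-isEquivalence = record { refl = ≈-refl ; sym = ≈-sym ; trans = ≈-trans }

  polySetoid : Setoid _ _
  polySetoid = record { isEquivalence = ≈-isEquivalence }

  open import Relation.Binary.Reasoning.Setoid polySetoid public
    using (step-≈-⟩; step-≈-⟨) renaming (begin_ to beginₚ_; _∎ to _∎ₚ)

  -- Addition is computed coefficientwise, so its laws hold on the nose.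
  +ₚ-identityʳ : ∀ f → f +ₚ [] ≡ f
  +ₚ-identityʳ [] = refl
  +ₚ-identityʳ (x ∷ f) = refl

  +ₚ-comm : ∀ f g → f +ₚ g ≡ g +ₚ f
  +ₚ-comm [] g = sym (+ₚ-identityʳ g)
  +ₚ-comm (x ∷ f) [] = refl
  +ₚ-comm (x ∷ f) (y ∷ g) = cong₂ _∷_ (+-comm x y) (+ₚ-comm f g)

  +ₚ-assoc : ∀ f g h → (f +ₚ g) +ₚ h ≡ f +ₚ (g +ₚ h)
  +ₚ-assoc [] g h = refl
  +ₚ-assoc (x ∷ f) [] h = refl
  +ₚ-assoc (x ∷ f) (y ∷ g) [] = refl
  +ₚ-assoc (x ∷ f) (y ∷ g) (z ∷ h) = cong₂ _∷_ (+-assoc x y z) (+ₚ-assoc f g h)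

  +ₚ-zeroʳ : ∀ f g → IsZero g → f +ₚ g ≈ f
  +ₚ-zeroʳ [] g z = zero≈[] z
  +ₚ-zeroʳ (x ∷ f) [] z = ≈-refl
  +ₚ-zeroʳ (x ∷ f) (y ∷ g) (y0 , z) = ∷≈ (trans (cong (x ⊕_) y0) (+-identityʳ x)) (+ₚ-zeroʳ f g z)

  zero-+ₚ : ∀ f g → IsZero f → IsZero g → IsZero (f +ₚ g)
  zero-+ₚ [] g zf zg = zg
  zero-+ₚ (x ∷ f) [] zf zg = zf
  zero-+ₚ (x ∷ f) (y ∷ g) (x0 , zf) (y0 , zg) = trans (cong₂ _⊕_ x0 y0) (+-identityʳ 0#) , zero-+ₚ f g zf zg

  +ₚ-congˡ : ∀ f {g h} → g ≈ h → f +ₚ g ≈ f +ₚ h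
  +ₚ-congˡ [] e = e
  +ₚ-congˡ (x ∷ f) ([]≈ {[]} z) = ≈-refl
  +ₚ-congˡ (x ∷ f) ([]≈ {z ∷ h} zz) = ≈-sym (+ₚ-zeroʳ (x ∷ f) (z ∷ h) zz)
  +ₚ-congˡ (x ∷ f) (≈[] {y} {g} z) = +ₚ-zeroʳ (x ∷ f) (y ∷ g) z
  +ₚ-congˡ (x ∷ f) (∷≈ p e) = ∷≈ (cong (x ⊕_) p) (+ₚ-congˡ f e)

  +ₚ-cong : ∀ {f f' g g'} → f ≈ f' → g ≈ g' → f +ₚ g ≈ f' +ₚ g'
  +ₚ-cong {f} {f'} {g} {g'} e1 e2 =
    ≈-trans (+ₚ-congˡ f e2)
      (≈-trans (≡⇒≈ (+ₚ-comm f g')) (≈-trans (+ₚ-congˡ g' e1) (≡⇒≈ (+ₚ-comm g' f'))))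

  -ₚ-inv : ∀ f → f +ₚ (-ₚ f) ≈ []
  -ₚ-inv [] = []≈ tt
  -ₚ-inv (x ∷ f) = ≈[] (-‿inverseʳ x , ≈[]⇒zero (-ₚ-inv f))

  zero-map : ∀ (h : F → F) → h 0# ≡ 0# → ∀ f → IsZero f → IsZero (map h f)
  zero-map h h0 [] z = tt
  zero-map h h0 (x ∷ f) (x0 , z) = trans (cong h x0) h0 , zero-map h h0 f z

  map-cong≈ : ∀ (h : F → F) → h 0# ≡ 0# → ∀ {f g} → f ≈ g → map h f ≈ map h g
  map-cong≈ h h0 ([]≈ {g} z) = []≈ (zero-map h h0 g z)
  map-cong≈ h h0 (≈[] {x} {f} z) = ≈[] (zero-map h h0 (x ∷ f) z)
  map-cong≈ h h0 (∷≈ p e) = ∷≈ (cong h p) (map-cong≈ h h0 e)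

  -ₚ-cong : ∀ {f g} → f ≈ g → -ₚ f ≈ -ₚ g
  -ₚ-cong = map-cong≈ ⊖_ -0#≈0#

  scale-cong : ∀ a {f g} → f ≈ g → scale a f ≈ scale a g
  scale-cong a = map-cong≈ (a ⊗_) (zeroʳ a)

  scale-+ₚ : ∀ a f g → scale a (f +ₚ g) ≡ scale a f +ₚ scale a g
  scale-+ₚ a [] g = refl
  scale-+ₚ a (x ∷ f) [] = refl
  scale-+ₚ a (x ∷ f) (y ∷ g) = cong₂ _∷_ (distribˡ a x y) (scale-+ₚ a f g)

  scale-scale : ∀ a b f → scale a (scale b f) ≡ scale (a ⊗ b) f
  scale-scale a b [] = refl
  scale-scale a b (x ∷ f) = cong₂ _∷_ (sym (*-assoc a b x)) (scale-scale a b f)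

  scale-⊕ : ∀ a b f → scale (a ⊕ b) f ≡ scale a f +ₚ scale b f
  scale-⊕ a b [] = refl
  scale-⊕ a b (x ∷ f) = cong₂ _∷_ (distribʳ x a b) (scale-⊕ a b f)

  scale-1 : ∀ f → scale 1# f ≡ f
  scale-1 [] = refl
  scale-1 (x ∷ f) = cong₂ _∷_ (*-identityˡ x) (scale-1 f)

  scale-0 : ∀ f → IsZero (scale 0# f)
  scale-0 [] = tt
  scale-0 (x ∷ f) = zeroˡ x , scale-0 f

  +ₚ-zeroˡ : ∀ f g → IsZero f → f +ₚ g ≈ g
  +ₚ-zeroˡ f g z = ≈-trans (≡⇒≈ (+ₚ-comm f g)) (+ₚ-zeroʳ g f z)

  +ₚ-inter : ∀ a b c d → (a +ₚ b) +ₚ (c +ₚ d) ≡ (a +ₚ c) +ₚ (b +ₚ d)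
  +ₚ-inter a b c d = begin
      (a +ₚ b) +ₚ (c +ₚ d) ≡⟨ +ₚ-assoc a b (c +ₚ d) ⟩
      a +ₚ (b +ₚ (c +ₚ d)) ≡⟨ cong (a +ₚ_) (sym (+ₚ-assoc b c d)) ⟩
      a +ₚ ((b +ₚ c) +ₚ d) ≡⟨ cong (λ t → a +ₚ (t +ₚ d)) (+ₚ-comm b c) ⟩
      a +ₚ ((c +ₚ b) +ₚ d) ≡⟨ cong (a +ₚ_) (+ₚ-assoc c b d) ⟩
      a +ₚ (c +ₚ (b +ₚ d)) ≡⟨ sym (+ₚ-assoc a c (b +ₚ d)) ⟩
      (a +ₚ c) +ₚ (b +ₚ d) ∎

  0∷+ : ∀ f g → (0# ∷ f) +ₚ (0# ∷ g) ≈ 0# ∷ (f +ₚ g)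
  0∷+ f g = ∷≈ (+-identityʳ 0#) ≈-refl

  zero-*ₚ[] : ∀ f → IsZero (f *ₚ [])
  zero-*ₚ[] [] = tt
  zero-*ₚ[] (a ∷ f) = refl , zero-*ₚ[] f

  zero-*ₚ : ∀ f g → IsZero f → IsZero (f *ₚ g)
  zero-*ₚ [] g z = tt
  zero-*ₚ (a ∷ f) g (a0 , z) = zero-+ₚ (scale a g) (0# ∷ f *ₚ g) (Eq.subst (λ t → IsZero (scale t g)) (sym a0) (scale-0 g)) (refl , zero-*ₚ f g z)

  *ₚ-congʳ : ∀ {f f'} g → f ≈ f' → f *ₚ g ≈ f' *ₚ g
  *ₚ-congʳ g ([]≈ {f'} z) = []≈ (zero-*ₚ f' g z)
  *ₚ-congʳ g (≈[] {x} {f} z) = zero≈[] (zero-*ₚ (x ∷ f) g z)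
  *ₚ-congʳ g (∷≈ {a} {b} p e) = +ₚ-cong (≡⇒≈ (cong (λ t → scale t g) p)) (∷≈ refl (*ₚ-congʳ g e))

  *ₚ-congˡ : ∀ f {g g'} → g ≈ g' → f *ₚ g ≈ f *ₚ g'
  *ₚ-congˡ [] e = []≈ tt
  *ₚ-congˡ (a ∷ f) e = +ₚ-cong (scale-cong a e) (∷≈ refl (*ₚ-congˡ f e))

  *ₚ-cong : ∀ {f f' g g'} → f ≈ f' → g ≈ g' → f *ₚ g ≈ f' *ₚ g'
  *ₚ-cong {f} {f'} {g} {g'} e1 e2 = ≈-trans (*ₚ-congˡ f e2) (*ₚ-congʳ g' e1)

  0∷* : ∀ x h → (0# ∷ x) *ₚ h ≈ 0# ∷ (x *ₚ h)
  0∷* x h = +ₚ-zeroˡ (scale 0# h) _ (scale-0 h)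

  *ₚ-distribʳ : ∀ f g h → (f +ₚ g) *ₚ h ≈ f *ₚ h +ₚ g *ₚ h
  *ₚ-distribʳ [] g h = ≈-refl
  *ₚ-distribʳ (a ∷ f) [] h = ≈-sym (≡⇒≈ (+ₚ-identityʳ _))
  *ₚ-distribʳ (a ∷ f) (b ∷ g) h =
    ≈-trans (+ₚ-cong (≡⇒≈ (scale-⊕ a b h)) (∷≈ refl (*ₚ-distribʳ f g h)))
    (≈-trans (+ₚ-congˡ (scale a h +ₚ scale b h) (≈-sym (0∷+ (f *ₚ h) (g *ₚ h))))
      (≡⇒≈ (+ₚ-inter (scale a h) (scale b h) (0# ∷ f *ₚ h) (0# ∷ g *ₚ h))))

  *ₚ-distribˡ : ∀ f g h → f *ₚ (g +ₚ h) ≈ f *ₚ g +ₚ f *ₚ h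
  *ₚ-distribˡ [] g h = []≈ tt
  *ₚ-distribˡ (a ∷ f) g h =
    ≈-trans (+ₚ-cong (≡⇒≈ (scale-+ₚ a g h)) (∷≈ refl (*ₚ-distribˡ f g h)))
    (≈-trans (+ₚ-congˡ (scale a g +ₚ scale a h) (≈-sym (0∷+ (f *ₚ g) (f *ₚ h))))
      (≡⇒≈ (+ₚ-inter (scale a g) (scale a h) (0# ∷ f *ₚ g) (0# ∷ f *ₚ h))))

  scale-*ˡ : ∀ c f g → scale c (f *ₚ g) ≈ scale c f *ₚ g
  scale-*ˡ c [] g = []≈ tt
  scale-*ˡ c (a ∷ f) g = ≈-trans (≡⇒≈ (scale-+ₚ c (scale a g) (0# ∷ f *ₚ g)))
    (+ₚ-cong (≡⇒≈ (scale-scale c a g)) (∷≈ (zeroʳ c) (scale-*ˡ c f g)))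

  *ₚ-0∷ : ∀ f g → f *ₚ (0# ∷ g) ≈ 0# ∷ (f *ₚ g)
  *ₚ-0∷ [] g = []≈ (refl , tt)
  *ₚ-0∷ (a ∷ f) g = ≈-trans (+ₚ-congˡ (scale a (0# ∷ g)) (∷≈ refl (*ₚ-0∷ f g)))
    (≈-trans (≡⇒≈ (cong₂ _∷_ (cong (_⊕ 0#) (zeroʳ a)) refl)) (∷≈ (+-identityʳ 0#) ≈-refl))

  *ₚ-single : ∀ g a → g *ₚ (a ∷ []) ≈ scale a g
  *ₚ-single [] a = []≈ tt
  *ₚ-single (b ∷ g) a = ∷≈ (trans (+-identityʳ (b ⊗ a)) (*-comm b a)) (*ₚ-single g a)

  ∷-split : ∀ a f → a ∷ f ≈ (a ∷ []) +ₚ (0# ∷ f)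
  ∷-split a f = ∷≈ (sym (+-identityʳ a)) ≈-refl

  *ₚ-comm : ∀ f g → f *ₚ g ≈ g *ₚ f
  *ₚ-comm [] g = ≈-sym (zero≈[] (zero-*ₚ[] g))
  *ₚ-comm (a ∷ f) g = ≈-sym (beginₚ
      g *ₚ (a ∷ f)                    ≈⟨ *ₚ-congˡ g (∷-split a f) ⟩
      g *ₚ ((a ∷ []) +ₚ (0# ∷ f))     ≈⟨ *ₚ-distribˡ g (a ∷ []) (0# ∷ f) ⟩
      g *ₚ (a ∷ []) +ₚ g *ₚ (0# ∷ f)  ≈⟨ +ₚ-cong (*ₚ-single g a) (*ₚ-0∷ g f) ⟩
      scale a g +ₚ (0# ∷ g *ₚ f)      ≈⟨ +ₚ-congˡ (scale a g) (∷≈ refl (*ₚ-comm g f)) ⟩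
      scale a g +ₚ (0# ∷ f *ₚ g)      ∎ₚ)

  *ₚ-assoc : ∀ f g h → (f *ₚ g) *ₚ h ≈ f *ₚ (g *ₚ h)
  *ₚ-assoc [] g h = []≈ tt
  *ₚ-assoc (a ∷ f) g h =
    ≈-trans (*ₚ-distribʳ (scale a g) (0# ∷ f *ₚ g) h)
    (+ₚ-cong (≈-sym (scale-*ˡ a g h)) (≈-trans (0∷* (f *ₚ g) h) (∷≈ refl (*ₚ-assoc f g h))))

  *ₚ-identityˡ : ∀ g → (1# ∷ []) *ₚ g ≈ g
  *ₚ-identityˡ g = ≈-trans (+ₚ-congˡ (scale 1# g) (zero≈[] (refl , tt))) (≈-trans (≡⇒≈ (+ₚ-identityʳ _)) (≡⇒≈ (scale-1 g)))

  -ₚ-invˡ : ∀ f → (-ₚ f) +ₚ f ≈ []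
  -ₚ-invˡ f = ≈-trans (≡⇒≈ (+ₚ-comm (-ₚ f) f)) (-ₚ-inv f)

  polyRing : CommutativeRing _ _
  polyRing = record
    { Carrier = Poly ; _≈_ = _≈_ ; _+_ = _+ₚ_ ; _*_ = _*ₚ_ ; -_ = -ₚ_ ; 0# = [] ; 1# = 1# ∷ []
    ; isCommutativeRing = record
      { isRing = record
        { +-isAbelianGroup = record
          { isGroup = record
            { isMonoid = record
              { isSemigroup = record
                { isMagma = record
                  { isEquivalence = ≈-isEquivalence
                  ; ∙-cong = +ₚ-cong }
                ; assoc = λ f g h → ≡⇒≈ (+ₚ-assoc f g h) }
              ; identity = (λ f → ≈-refl) , (λ f → ≡⇒≈ (+ₚ-identityʳ f)) }
            ; inverse = -ₚ-invˡ , -ₚ-inv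
            ; ⁻¹-cong = -ₚ-cong }
          ; comm = λ f g → ≡⇒≈ (+ₚ-comm f g) }
        ; *-cong = *ₚ-cong
        ; *-assoc = *ₚ-assoc
        ; *-identity = *ₚ-identityˡ , (λ g → ≈-trans (*ₚ-comm g _) (*ₚ-identityˡ g))
        ; distrib = *ₚ-distribˡ , (λ h f g → *ₚ-distribʳ f g h) }
      ; *-comm = *ₚ-comm } }

  module PolyRing = CommutativeRing polyRing
  module PolyRingProps = Algebra.Properties.Ring PolyRing.ring
  module +CS = CSP PolyRing.+-commutativeSemigroup
  module *CS = CSP PolyRing.*-commutativeSemigroup
  module F+CS = CSP FieldRing.+-commutativeSemigroup
  module F*CS = CSP FieldRing.*-commutativeSemigroup

  monic : ∀ {n} → Vec F n → Poly
  monic = D.monic K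

  inv : ∀ x → x ≢ 0# → F
  inv x p = proj₁ (inverse x p)

  inv-r : ∀ x (p : x ≢ 0#) → x ⊗ inv x p ≡ 1#
  inv-r x p = proj₂ (inverse x p)

  no-zero-divisors : ∀ a b → a ⊗ b ≡ 0# → a ≡ 0# ⊎ b ≡ 0#
  no-zero-divisors a b e with a ≟ 0#
  ... | yes a0 = inj₁ a0
  ... | no a≢0 = inj₂ (begin
      b ≡⟨ sym (*-identityˡ b) ⟩
      1# ⊗ b ≡⟨ cong (_⊗ b) (sym (inv-r a a≢0)) ⟩
      (a ⊗ inv a a≢0) ⊗ b ≡⟨ cong (_⊗ b) (*-comm a _) ⟩
      (inv a a≢0 ⊗ a) ⊗ b ≡⟨ *-assoc _ a b ⟩
      inv a a≢0 ⊗ (a ⊗ b) ≡⟨ cong (inv a a≢0 ⊗_) e ⟩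
      inv a a≢0 ⊗ 0# ≡⟨ zeroʳ _ ⟩
      0# ∎)

  1≢0 : 1# ≢ 0#
  1≢0 e = 0≢1 (sym e)

  zero-last : ∀ xs b → IsZero (xs ++ [ b ]) → b ≡ 0#
  zero-last [] b (b0 , _) = b0
  zero-last (x ∷ xs) b (_ , z) = zero-last xs b z

  lead-≈ : ∀ xs ys a b → a ≢ 0# → b ≢ 0# → xs ++ [ a ] ≈ ys ++ [ b ] → xs ≡ ys × a ≡ b
  lead-≈ [] [] a b _ _ (∷≈ p _) = refl , p
  lead-≈ [] (y ∷ ys) a b _ nb (∷≈ p e) = ⊥-elim (nb (zero-last ys b (≈[]⇒zero (≈-sym e))))
  lead-≈ (x ∷ xs) [] a b na _ (∷≈ p e) = ⊥-elim (na (zero-last xs a (≈[]⇒zero e)))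
  lead-≈ (x ∷ xs) (y ∷ ys) a b na nb (∷≈ p e) with lead-≈ xs ys a b na nb e
  ... | q , r = cong₂ _∷_ p q , r

  monic-inj : ∀ {n} (u v : Vec F n) → monic u ≈ monic v → u ≡ v
  monic-inj u v e = toList-inj u v (proj₁ (lead-≈ (toList u) (toList v) 1# 1# 1≢0 1≢0 e))
    where
    toList-inj : ∀ {n} (u v : Vec F n) → toList u ≡ toList v → u ≡ v
    toList-inj []ᵥ []ᵥ _ = refl
    toList-inj (x ∷ᵥ u) (y ∷ᵥ v) e = cong₂ _∷ᵥ_ (∷-injectiveˡ e) (toList-inj u v (∷-injectiveʳ e))

  add-monic : ∀ {n} (xs : List F) (w : Vec F n) → length xs ≤ n → Σ[ w' ∈ Vec F n ] xs +ₚ monic w ≡ monic w'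
  add-monic [] w _ = w , refl
  add-monic (y ∷ ys) (z ∷ᵥ w) (s≤s l) with add-monic ys w l
  ... | w' , e = ((y ⊕ z) ∷ᵥ w') , cong ((y ⊕ z) ∷_) e

  mul-monic : ∀ {m k} (a : Vec F m) (b : Vec F k) → Σ[ v ∈ Vec F (m + k) ] monic a *ₚ monic b ≡ monic v
  mul-monic []ᵥ b = b , trans (cong (_+ₚ (0# ∷ [])) (scale-1 (monic b))) (add-0 (toList b))
    where
    add-0 : ∀ xs → (xs ++ [ 1# ]) +ₚ (0# ∷ []) ≡ xs ++ [ 1# ]
    add-0 [] = cong [_] (+-identityʳ 1#)
    add-0 (x ∷ xs) = cong₂ _∷_ (+-identityʳ x) (+ₚ-identityʳ (xs ++ [ 1# ]))
  mul-monic {suc m} {k} (x ∷ᵥ a) b with mul-monic a b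
  ... | v , e with add-monic (scale x (monic b)) (0# ∷ᵥ v) lenle
    where
    lenle : length (scale x (monic b)) ≤ suc (m + k)
    lenle = Eq.subst (_≤ suc (m + k)) (sym (trans (length-map (x ⊗_) (monic b)) (trans (length-++ (toList b)) (cong (_+ 1) (VP.length-toList b)))))
              (Eq.subst (_≤ suc (m + k)) (sym (NP.+-comm k 1)) (s≤s (NP.m≤n+m k m)))
  ... | w' , e2 = w' , trans (cong (λ t → scale x (monic b) +ₚ (0# ∷ t)) e) e2

  scale-*ʳ : ∀ c f g → f *ₚ scale c g ≈ scale c (f *ₚ g)
  scale-*ʳ c f g = ≈-trans (*ₚ-comm f (scale c g)) (≈-trans (≈-sym (scale-*ˡ c g f)) (scale-cong c (*ₚ-comm g f)))

  record Normalized (xs : Poly) : Set where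
    constructor normalized
    field
      c : F
      c≢0 : c ≢ 0#
      e : ℕ
      v : Vec F e
      eq : xs ≈ scale c (monic v)
      e< : e < length xs

  normalize : ∀ xs → IsZero xs ⊎ Normalized xs
  normalize [] = inj₁ tt
  normalize (a ∷ xs) with normalize xs
  ... | inj₁ z with a ≟ 0#
  ...   | yes a0 = inj₁ (a0 , z)
  ...   | no a≢0 = inj₂ (normalized a a≢0 0 []ᵥ (∷≈ (sym (*-identityʳ a)) (zero≈[] z)) (s≤s z≤n))
  normalize (a ∷ xs) | inj₂ (normalized c c≢0 e v eq e<) =
    inj₂ (normalized c c≢0 (suc e) (inv c c≢0 ⊗ a ∷ᵥ v) (∷≈ (sym ca) eq) (s≤s e<))
    where
    ca : c ⊗ (inv c c≢0 ⊗ a) ≡ a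
    ca = trans (sym (*-assoc c _ a)) (trans (cong (_⊗ a) (inv-r c c≢0)) (*-identityˡ a))

  scale-last : ∀ c xs → scale c (xs ++ [ 1# ]) ≡ map (c ⊗_) xs ++ [ c ⊗ 1# ]
  scale-last c [] = refl
  scale-last c (x ∷ xs) = cong (_ ∷_) (scale-last c xs)

  scaledMonic≢0 : ∀ c {n} (v : Vec F n) → c ≢ 0# → ¬ IsZero (scale c (monic v))
  scaledMonic≢0 c v c≢0 z = c≢0 (trans (sym (*-identityʳ c)) (zero-last _ _ (subst IsZero (scale-last c (toList v)) z)))

  monic≢0 : ∀ {n} (v : Vec F n) → ¬ IsZero (monic v)
  monic≢0 v z = 1≢0 (zero-last (toList v) 1# z)

  -- Monic polynomials are not zero divisors (compare leading coefficients).
  monic*-zero : ∀ {d} (p : Vec F d) x → IsZero (monic p *ₚ x) → IsZero x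
  monic*-zero p x z with normalize x
  ... | inj₁ zx = zx
  ... | inj₂ (normalized c c≢0 e v eq e<) with mul-monic p v
  ... | w , we = ⊥-elim (scaledMonic≢0 c w c≢0 (≈[]⇒zero (≈-trans (≈-sym step) (zero≈[] z))))
    where
    step : monic p *ₚ x ≈ scale c (monic w)
    step = ≈-trans (*ₚ-congˡ (monic p) eq) (≈-trans (scale-*ʳ c (monic p) (monic v)) (scale-cong c (≡⇒≈ we)))

  infixl 6 _-ₚ_
  _-ₚ_ : Poly → Poly → Poly
  f -ₚ g = f +ₚ (-ₚ g)

  zero-diff : ∀ x y → IsZero (x -ₚ y) → x ≈ y
  zero-diff x y z = beginₚ
    x ≈⟨ ≈-sym (≡⇒≈ (+ₚ-identityʳ x)) ⟩
    x +ₚ [] ≈⟨ +ₚ-congˡ x (≈-sym (-ₚ-invˡ y)) ⟩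
    x +ₚ ((-ₚ y) +ₚ y) ≈⟨ ≡⇒≈ (sym (+ₚ-assoc x (-ₚ y) y)) ⟩
    (x -ₚ y) +ₚ y ≈⟨ +ₚ-zeroˡ (x -ₚ y) y z ⟩
    y ∎ₚ

  *-diff : ∀ p x y → p *ₚ (x -ₚ y) ≈ p *ₚ x -ₚ p *ₚ y
  *-diff p x y = ≈-trans (*ₚ-distribˡ p x (-ₚ y)) (+ₚ-congˡ (p *ₚ x) (≈-sym (PolyRingProps.-‿distribʳ-* p y)))

  monic-cancel : ∀ {d} (p : Vec F d) x y → monic p *ₚ x ≈ monic p *ₚ y → x ≈ y
  monic-cancel p x y e = zero-diff x y (monic*-zero p (x -ₚ y)
    (≈[]⇒zero (≈-trans (*-diff (monic p) x y) (≈-trans (+ₚ-congˡ (monic p *ₚ x) (-ₚ-cong (≈-sym e))) (-ₚ-inv (monic p *ₚ x))))))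

  record MonicQuotient (d n : ℕ) (x : Poly) : Set where
    constructor monicQuotient
    field
      d≤n : d ≤ n
      h : Vec F (n ∸ d)
      eq : x ≈ monic h

  quot-monic : ∀ {d n} (p : Vec F d) (f : Vec F n) x → monic p *ₚ x ≈ monic f → MonicQuotient d n x
  quot-monic {d} {n} p f x e with normalize x
  ... | inj₁ zx = ⊥-elim (monic≢0 f (≈[]⇒zero (≈-trans (≈-sym e) p·x≈0)))
    where
    p·x≈0 : monic p *ₚ x ≈ []
    p·x≈0 = ≈-trans (*ₚ-comm (monic p) x) (zero≈[] (zero-*ₚ x (monic p) zx))
  ... | inj₂ (normalized c c≢0 e' v eq e<) with mul-monic p v
  ... | w , we = monicQuotient d≤n (proj₁ quotient) (proj₂ quotient)
    where
    step : scale c (monic w) ≈ monic f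
    step = ≈-trans (≈-sym (≈-trans (*ₚ-congˡ (monic p) eq) (≈-trans (scale-*ʳ c (monic p) (monic v)) (scale-cong c (≡⇒≈ we))))) e
    nz : map (c ⊗_) (toList w) ≡ toList f × c ⊗ 1# ≡ 1#
    nz = lead-≈ _ _ _ _ (λ c1 → c≢0 (trans (sym (*-identityʳ c)) c1)) 1≢0
           (≈-trans (≈-sym (≡⇒≈ (scale-last c (toList w)))) step)
    c1 : c ≡ 1#
    c1 = trans (sym (*-identityʳ c)) (proj₂ nz)
    len : d + e' ≡ n
    len = trans (sym (VP.length-toList w)) (trans (sym (length-map (c ⊗_) (toList w))) (trans (cong length (proj₁ nz)) (VP.length-toList f)))
    d≤n : d ≤ n
    d≤n = subst (d ≤_) len (NP.m≤m+n d e')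
    e'≡ : e' ≡ n ∸ d
    e'≡ = trans (sym (NP.m+n∸m≡n d e')) (cong (_∸ d) len)
    xeq' : x ≈ monic v
    xeq' = ≈-trans eq (≡⇒≈ (trans (cong (λ t → scale t (monic v)) c1) (scale-1 (monic v))))
    quotient : Σ[ h ∈ Vec F (n ∸ d) ] x ≈ monic h
    quotient = subst (λ k → Σ[ h ∈ Vec F k ] x ≈ monic h) e'≡ (v , xeq')

  -- One step of long division: the last coefficient t of a remainder of length d+1
  -- is removed by subtracting t · m.
  splitLast : ∀ {d} → Vec F (suc d) → Vec F d × F
  splitLast {zero} (x ∷ᵥ []ᵥ) = []ᵥ , x
  splitLast {suc d} (x ∷ᵥ v) = (x ∷ᵥ proj₁ (splitLast v)) , proj₂ (splitLast v)

  splitLast-eq : ∀ {d} (v : Vec F (suc d)) → toList v ≡ toList (proj₁ (splitLast v)) ++ [ proj₂ (splitLast v) ]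
  splitLast-eq {zero} (x ∷ᵥ []ᵥ) = refl
  splitLast-eq {suc d} (x ∷ᵥ v) = cong (x ∷_) (splitLast-eq v)

  reduceBy : ∀ {d} → F → Vec F d → Vec F d → Vec F d
  reduceBy t i m = zipWith (λ u y → u ⊕ (⊖ (t ⊗ y))) i m

  reduceBy-eq : ∀ {d} (i m : Vec F d) t → toList i ++ [ t ] ≈ toList (reduceBy t i m) +ₚ scale t (monic m)
  reduceBy-eq []ᵥ []ᵥ t = ∷≈ (sym (*-identityʳ t)) (≈-refl)
  reduceBy-eq (u ∷ᵥ i) (y ∷ᵥ m) t = ∷≈ restore (reduceBy-eq i m t)
    where
    restore : u ≡ (u ⊕ (⊖ (t ⊗ y))) ⊕ (t ⊗ y)
    restore = sym (trans (+-assoc u _ _) (trans (cong (u ⊕_) (-‿inverseˡ (t ⊗ y))) (+-identityʳ u)))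

  zero-replicate : ∀ d → IsZero (toList (replicate d 0#))
  zero-replicate zero = tt
  zero-replicate (suc d) = refl , zero-replicate d

  -- Division with remainder by a monic polynomial m of degree d: a ≈ m · q + r with
  -- r of length d, by recursion on a: divide the higher coefficients, bring down
  -- the next one and reduce the remainder once more.
  divide : ∀ {d} (m : Vec F d) a → Σ[ q ∈ Poly ] Σ[ r ∈ Vec F d ] a ≈ monic m *ₚ q +ₚ toList r
  divide {d} m [] = [] , replicate d 0# , zero-case
    where
    zero-case : [] ≈ monic m *ₚ [] +ₚ toList (replicate d 0#)
    zero-case = []≈ (zero-+ₚ (monic m *ₚ []) _ (zero-*ₚ[] (monic m)) (zero-replicate d))
  divide {d} m (x ∷ a') with divide m a'
  ... | q' , r' , e' = (t ∷ q') , reduceBy t i m , chain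
    where
    i = proj₁ (splitLast (x ∷ᵥ r'))
    t = proj₂ (splitLast (x ∷ᵥ r'))
    R' = toList r'
    R = toList (reduceBy t i m)
    Mm = monic m
    chain : x ∷ a' ≈ Mm *ₚ (t ∷ q') +ₚ R
    chain = beginₚ
      x ∷ a' ≈⟨ ∷≈ refl e' ⟩
      x ∷ (Mm *ₚ q' +ₚ R') ≈⟨ ∷≈ (sym (+-identityʳ x)) (≡⇒≈ (+ₚ-comm (Mm *ₚ q') R')) ⟩
      (x ∷ R') +ₚ (0# ∷ Mm *ₚ q') ≈⟨ +ₚ-cong (≡⇒≈ (splitLast-eq (x ∷ᵥ r'))) ≈-refl ⟩
      (toList i ++ [ t ]) +ₚ (0# ∷ Mm *ₚ q') ≈⟨ +ₚ-cong (reduceBy-eq i m t) ≈-refl ⟩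
      (R +ₚ scale t Mm) +ₚ (0# ∷ Mm *ₚ q') ≈⟨ ≡⇒≈ (+ₚ-assoc R (scale t Mm) _) ⟩
      R +ₚ (scale t Mm +ₚ (0# ∷ Mm *ₚ q')) ≈⟨ +ₚ-congˡ R (+ₚ-congˡ (scale t Mm) (∷≈ refl (*ₚ-comm Mm q'))) ⟩
      R +ₚ ((t ∷ q') *ₚ Mm) ≈⟨ +ₚ-congˡ R (*ₚ-comm (t ∷ q') Mm) ⟩
      R +ₚ Mm *ₚ (t ∷ q') ≈⟨ ≡⇒≈ (+ₚ-comm R _) ⟩
      Mm *ₚ (t ∷ q') +ₚ R ∎ₚ

  +ₚ-cancel : ∀ y z → (y +ₚ z) -ₚ y ≈ z
  +ₚ-cancel y z = beginₚ
    (y +ₚ z) -ₚ y ≈⟨ +ₚ-cong (≡⇒≈ (+ₚ-comm y z)) ≈-refl ⟩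
    (z +ₚ y) -ₚ y ≈⟨ ≡⇒≈ (+ₚ-assoc z y (-ₚ y)) ⟩
    z +ₚ (y -ₚ y) ≈⟨ +ₚ-congˡ z (-ₚ-inv y) ⟩
    z +ₚ [] ≈⟨ ≡⇒≈ (+ₚ-identityʳ z) ⟩
    z ∎ₚ

  scale-inv : ∀ c (c≢0 : c ≢ 0#) f → scale (inv c c≢0) (scale c f) ≈ f
  scale-inv c c≢0 f = ≡⇒≈ (trans (scale-scale _ c f) (trans (cong (λ t → scale t f) (trans (*-comm _ c) (inv-r c c≢0))) (scale-1 f)))

  record GCD {d} (m : Vec F d) (a : Poly) : Set where
    constructor mkG
    field
      e : ℕ
      g : Vec F e
      x y u v : Poly
      gx : monic g *ₚ x ≈ monic m
      gy : monic g *ₚ y ≈ a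
      bez : u *ₚ a +ₚ v *ₚ monic m ≈ monic g

  one : Poly
  one = 1# ∷ []

  *ₚ-identityʳ : ∀ f → f *ₚ one ≈ f
  *ₚ-identityʳ f = ≈-trans (*ₚ-comm f one) (*ₚ-identityˡ f)

  -- One Euclidean step, a ≈ m·q + R with R ≈ c·r: a common divisor G of r and m
  -- divides a ...
  euclid-divides : ∀ m q R r a c (G x y : Poly) → a ≈ m *ₚ q +ₚ R → R ≈ scale c r →
    G *ₚ x ≈ r → G *ₚ y ≈ m → G *ₚ (y *ₚ q +ₚ scale c x) ≈ a
  euclid-divides m q R r a c G x y ea eR gx gy = beginₚ
    G *ₚ (y *ₚ q +ₚ scale c x)          ≈⟨ *ₚ-distribˡ G _ _ ⟩
    G *ₚ (y *ₚ q) +ₚ G *ₚ scale c x     ≈⟨ +ₚ-cong (≈-sym (*ₚ-assoc G y q)) (scale-*ʳ c G x) ⟩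
    (G *ₚ y) *ₚ q +ₚ scale c (G *ₚ x)   ≈⟨ +ₚ-cong (*ₚ-congʳ q gy) (scale-cong c gx) ⟩
    m *ₚ q +ₚ scale c r                 ≈⟨ +ₚ-congˡ (m *ₚ q) (≈-sym eR) ⟩
    m *ₚ q +ₚ R                         ≈⟨ ≈-sym ea ⟩
    a                                   ∎ₚ

  -- ... and a Bézout identity u·m + v·r ≈ G for (m, r) becomes one for (a, m),
  -- using r ≈ c⁻¹ (a - m q).
  euclid-bezout : ∀ m q R r a c (c≢0 : c ≢ 0#) (G u v : Poly) → a ≈ m *ₚ q +ₚ R → R ≈ scale c r →
    u *ₚ m +ₚ v *ₚ r ≈ G →
    scale (inv c c≢0) v *ₚ a +ₚ (u -ₚ scale (inv c c≢0) v *ₚ q) *ₚ m ≈ G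
  euclid-bezout m q R r a c c≢0 G u v ea eR bez = beginₚ
    W *ₚ a +ₚ (u -ₚ W *ₚ q) *ₚ m            ≈⟨ +ₚ-congˡ (W *ₚ a) (*ₚ-distribʳ u (-ₚ (W *ₚ q)) m) ⟩
    W *ₚ a +ₚ (u *ₚ m +ₚ (-ₚ (W *ₚ q)) *ₚ m) ≈⟨ +ₚ-congˡ (W *ₚ a) (+ₚ-congˡ (u *ₚ m) (≈-sym (PolyRingProps.-‿distribˡ-* (W *ₚ q) m))) ⟩
    W *ₚ a +ₚ (u *ₚ m -ₚ (W *ₚ q) *ₚ m)     ≈⟨ +ₚ-congˡ (W *ₚ a) (+ₚ-congˡ (u *ₚ m) (-ₚ-cong (≈-trans (*ₚ-assoc W q m) (*ₚ-congˡ W (*ₚ-comm q m))))) ⟩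
    W *ₚ a +ₚ (u *ₚ m -ₚ W *ₚ (m *ₚ q))     ≈⟨ +CS.x∙yz≈y∙xz (W *ₚ a) (u *ₚ m) _ ⟩
    u *ₚ m +ₚ (W *ₚ a -ₚ W *ₚ (m *ₚ q))     ≈⟨ +ₚ-congˡ (u *ₚ m) (≈-sym v·r≈) ⟩
    u *ₚ m +ₚ v *ₚ r                         ≈⟨ bez ⟩
    G                                        ∎ₚ
    where
    c⁻¹ = inv c c≢0
    W = scale c⁻¹ v
    r≈ : r ≈ scale c⁻¹ (a -ₚ m *ₚ q)
    r≈ = beginₚ
      r                                  ≈⟨ ≈-sym (scale-inv c c≢0 r) ⟩
      scale c⁻¹ (scale c r)              ≈⟨ scale-cong c⁻¹ (≈-sym eR) ⟩
      scale c⁻¹ R                        ≈⟨ scale-cong c⁻¹ (≈-sym (+ₚ-cancel (m *ₚ q) R)) ⟩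
      scale c⁻¹ ((m *ₚ q +ₚ R) -ₚ m *ₚ q) ≈⟨ scale-cong c⁻¹ (+ₚ-cong (≈-sym ea) ≈-refl) ⟩
      scale c⁻¹ (a -ₚ m *ₚ q)            ∎ₚ
    v·r≈ : v *ₚ r ≈ W *ₚ a -ₚ W *ₚ (m *ₚ q)
    v·r≈ = beginₚ
      v *ₚ r                               ≈⟨ *ₚ-congˡ v r≈ ⟩
      v *ₚ scale c⁻¹ (a -ₚ m *ₚ q)         ≈⟨ scale-*ʳ c⁻¹ v _ ⟩
      scale c⁻¹ (v *ₚ (a -ₚ m *ₚ q))       ≈⟨ scale-*ˡ c⁻¹ v _ ⟩
      W *ₚ (a -ₚ m *ₚ q)                   ≈⟨ *-diff W a (m *ₚ q) ⟩
      W *ₚ a -ₚ W *ₚ (m *ₚ q)              ∎ₚ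

  -- The Euclidean algorithm, by recursion on the degree of m: divide a by m and
  -- recurse on (remainder, m), the remainder rescaled to be monic.
  gcdFuel : ∀ n {d} → d < n → (m : Vec F d) (a : Poly) → GCD m a
  gcdFuel (suc n) {d} (s≤s d≤n) m a with divide m a
  ... | q , r , ea with normalize (toList r)
  ... | inj₁ zr = mkG _ m one q [] one (*ₚ-identityʳ (monic m))
          (≈-sym (≈-trans ea (+ₚ-zeroʳ _ _ zr))) (*ₚ-identityˡ (monic m))
  ... | inj₂ (normalized c c≢0 e' r' eqr e'<) with gcdFuel n (NP.≤-trans e'< (subst (_≤ n) (sym (VP.length-toList r)) d≤n)) r' (monic m)
  ... | mkG e g x' y' u' v' gx' gy' bez' =
    mkG e g y' (y' *ₚ q +ₚ scale c x') (scale (inv c c≢0) v') (u' -ₚ scale (inv c c≢0) v' *ₚ q) gy'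
      (euclid-divides (monic m) q (toList r) (monic r') a c (monic g) x' y' ea eqr gx' gy')
      (euclid-bezout (monic m) q (toList r) (monic r') a c c≢0 (monic g) u' v' ea eqr bez')

  gcd : ∀ {d} (m : Vec F d) (a : Poly) → GCD m a
  gcd {d} m a = gcdFuel (suc d) (NP.n<1+n d) m a

  SF : ∀ {n} → Vec F n → Set
  SF f = ∀ {j} (g : Vec F (suc j)) (x : Poly) → ¬ ((monic g *ₚ monic g) *ₚ x ≈ monic f)

  Coprimeₚ : Poly → Poly → Set
  Coprimeₚ a b = Σ[ s ∈ Poly ] Σ[ t ∈ Poly ] s *ₚ a +ₚ t *ₚ b ≈ one

  coprime-sym : ∀ {a b} → Coprimeₚ a b → Coprimeₚ b a
  coprime-sym {a} {b} (s , t , e) = t , s , ≈-trans (≡⇒≈ (+ₚ-comm (t *ₚ b) (s *ₚ a))) e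

  coprime-* : ∀ {a b c} → Coprimeₚ a b → Coprimeₚ a c → Coprimeₚ a (b *ₚ c)
  coprime-* {a} {b} {c} (s , t , e) (s' , t' , e') = S , t *ₚ t' , eq
    where
    S = s *ₚ (s' *ₚ a +ₚ t' *ₚ c) +ₚ (t *ₚ b) *ₚ s'
    X = s' *ₚ a +ₚ t' *ₚ c
    eq : S *ₚ a +ₚ (t *ₚ t') *ₚ (b *ₚ c) ≈ one
    eq = beginₚ
      S *ₚ a +ₚ (t *ₚ t') *ₚ (b *ₚ c)
        ≈⟨ +ₚ-cong (*ₚ-distribʳ (s *ₚ X) ((t *ₚ b) *ₚ s') a) (*CS.interchange t t' b c) ⟩
      ((s *ₚ X) *ₚ a +ₚ ((t *ₚ b) *ₚ s') *ₚ a) +ₚ (t *ₚ b) *ₚ (t' *ₚ c)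
        ≈⟨ +ₚ-cong (+ₚ-cong (*CS.xy∙z≈xz∙y s X a) (*ₚ-assoc (t *ₚ b) s' a)) ≈-refl ⟩
      ((s *ₚ a) *ₚ X +ₚ (t *ₚ b) *ₚ (s' *ₚ a)) +ₚ (t *ₚ b) *ₚ (t' *ₚ c)
        ≈⟨ ≡⇒≈ (+ₚ-assoc ((s *ₚ a) *ₚ X) ((t *ₚ b) *ₚ (s' *ₚ a)) ((t *ₚ b) *ₚ (t' *ₚ c))) ⟩
      (s *ₚ a) *ₚ X +ₚ ((t *ₚ b) *ₚ (s' *ₚ a) +ₚ (t *ₚ b) *ₚ (t' *ₚ c))
        ≈⟨ +ₚ-congˡ ((s *ₚ a) *ₚ X) (≈-sym (*ₚ-distribˡ (t *ₚ b) (s' *ₚ a) (t' *ₚ c))) ⟩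
      (s *ₚ a) *ₚ X +ₚ (t *ₚ b) *ₚ X
        ≈⟨ ≈-sym (*ₚ-distribʳ (s *ₚ a) (t *ₚ b) X) ⟩
      (s *ₚ a +ₚ t *ₚ b) *ₚ X
        ≈⟨ *ₚ-cong e e' ⟩
      one *ₚ one
        ≈⟨ *ₚ-identityˡ one ⟩
      one ∎ₚ

  coprime-divides : ∀ {a b c z} → Coprimeₚ a b → b *ₚ c ≈ a *ₚ z → Σ[ w ∈ Poly ] c ≈ a *ₚ w
  coprime-divides {a} {b} {c} {z} (s , t , e) bc = (s *ₚ c +ₚ t *ₚ z) , chain
    where
    chain : c ≈ a *ₚ (s *ₚ c +ₚ t *ₚ z)
    chain = beginₚ
      c ≈⟨ ≈-sym (*ₚ-identityˡ c) ⟩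
      one *ₚ c ≈⟨ *ₚ-congʳ c (≈-sym e) ⟩
      (s *ₚ a +ₚ t *ₚ b) *ₚ c ≈⟨ *ₚ-distribʳ (s *ₚ a) (t *ₚ b) c ⟩
      (s *ₚ a) *ₚ c +ₚ (t *ₚ b) *ₚ c ≈⟨ +ₚ-cong (*CS.xy∙z≈y∙xz s a c) (*ₚ-assoc t b c) ⟩
      a *ₚ (s *ₚ c) +ₚ t *ₚ (b *ₚ c) ≈⟨ +ₚ-congˡ (a *ₚ (s *ₚ c)) (*ₚ-congˡ t bc) ⟩
      a *ₚ (s *ₚ c) +ₚ t *ₚ (a *ₚ z) ≈⟨ +ₚ-congˡ (a *ₚ (s *ₚ c)) (*CS.x∙yz≈y∙xz t a z) ⟩
      a *ₚ (s *ₚ c) +ₚ a *ₚ (t *ₚ z) ≈⟨ ≈-sym (*ₚ-distribˡ a (s *ₚ c) (t *ₚ z)) ⟩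
      a *ₚ (s *ₚ c +ₚ t *ₚ z) ∎ₚ

  monic-degree : ∀ {a b} (u : Vec F a) (v : Vec F b) → monic u ≈ monic v → a ≡ b
  monic-degree u v e = trans (sym (VP.length-toList u)) (trans (cong length (proj₁ (lead-≈ (toList u) (toList v) 1# 1# 1≢0 1≢0 e))) (VP.length-toList v))

  squareDivisor-trivial : ∀ {k n} (yv : Vec F k) {y : Poly} (hv : Vec F n) → y ≈ monic yv → SF hv → (Σ[ w ∈ Poly ] monic hv ≈ (y *ₚ y) *ₚ w) → y ≈ one
  squareDivisor-trivial []ᵥ hv e _ _ = e
  squareDivisor-trivial (a ∷ᵥ v) hv e sf (w , eq) = ⊥-elim (sf (a ∷ᵥ v) w (≈-sym (≈-trans eq (*ₚ-congʳ w (*ₚ-cong e e)))))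

  square-assoc : ∀ a b h → ((a *ₚ b) *ₚ (a *ₚ b)) *ₚ h ≈ a *ₚ (a *ₚ ((b *ₚ b) *ₚ h))
  square-assoc a b h = beginₚ
    ((a *ₚ b) *ₚ (a *ₚ b)) *ₚ h ≈⟨ *ₚ-congʳ h (*CS.interchange a b a b) ⟩
    ((a *ₚ a) *ₚ (b *ₚ b)) *ₚ h ≈⟨ *ₚ-assoc (a *ₚ a) (b *ₚ b) h ⟩
    (a *ₚ a) *ₚ ((b *ₚ b) *ₚ h) ≈⟨ *ₚ-assoc a a _ ⟩
    a *ₚ (a *ₚ ((b *ₚ b) *ₚ h)) ∎ₚ

  -- With δ = gcd(g', g) write
  -- g = δ y, g' = δ x with x, y coprime; cancelling δ² gives y² h ≈ x² h', so
  -- y² ∣ h' and x² ∣ h by Gauss' lemma, forcing x ≈ y ≈ 1.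
  squarePart-unique : ∀ {d k d' k'} (g : Vec F d) (h : Vec F k) (g' : Vec F d') (h' : Vec F k') → SF h → SF h' →
    (monic g *ₚ monic g) *ₚ monic h ≈ (monic g' *ₚ monic g') *ₚ monic h' → monic g ≈ monic g'
  squarePart-unique g h g' h' sfh sfh' eq with gcd g' (monic g)
  ... | mkG e δ x y u v gx gy bez = ≈-trans (≈-sym gy) (≈-trans (*ₚ-congˡ Mδ (≈-trans y≈1 (≈-sym x≈1))) gx)
    where
    Mδ = monic δ
    x-monic = quot-monic δ g' x gx
    y-monic = quot-monic δ g y gy
    yx-coprime : Coprimeₚ y x
    yx-coprime = u , v , monic-cancel δ _ _ (beginₚ
      Mδ *ₚ (u *ₚ y +ₚ v *ₚ x) ≈⟨ *ₚ-distribˡ Mδ (u *ₚ y) (v *ₚ x) ⟩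
      Mδ *ₚ (u *ₚ y) +ₚ Mδ *ₚ (v *ₚ x) ≈⟨ +ₚ-cong (*CS.x∙yz≈y∙xz Mδ u y) (*CS.x∙yz≈y∙xz Mδ v x) ⟩
      u *ₚ (Mδ *ₚ y) +ₚ v *ₚ (Mδ *ₚ x) ≈⟨ +ₚ-cong (*ₚ-congˡ u gy) (*ₚ-congˡ v gx) ⟩
      u *ₚ monic g +ₚ v *ₚ monic g' ≈⟨ bez ⟩
      Mδ ≈⟨ ≈-sym (*ₚ-identityʳ Mδ) ⟩
      Mδ *ₚ one ∎ₚ)
    δ²-cancelled : (y *ₚ y) *ₚ monic h ≈ (x *ₚ x) *ₚ monic h'
    δ²-cancelled = monic-cancel δ _ _ (monic-cancel δ _ _ (beginₚ
      Mδ *ₚ (Mδ *ₚ ((y *ₚ y) *ₚ monic h)) ≈⟨ ≈-sym (square-assoc Mδ y (monic h)) ⟩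
      ((Mδ *ₚ y) *ₚ (Mδ *ₚ y)) *ₚ monic h ≈⟨ *ₚ-congʳ (monic h) (*ₚ-cong gy gy) ⟩
      (monic g *ₚ monic g) *ₚ monic h ≈⟨ eq ⟩
      (monic g' *ₚ monic g') *ₚ monic h' ≈⟨ ≈-sym (*ₚ-congʳ (monic h') (*ₚ-cong gx gx)) ⟩
      ((Mδ *ₚ x) *ₚ (Mδ *ₚ x)) *ₚ monic h' ≈⟨ square-assoc Mδ x (monic h') ⟩
      Mδ *ₚ (Mδ *ₚ ((x *ₚ x) *ₚ monic h')) ∎ₚ))
    squares-coprime : Coprimeₚ (y *ₚ y) (x *ₚ x)
    squares-coprime = coprime-sym (coprime-* (coprime-sym (coprime-* yx-coprime yx-coprime)) (coprime-sym (coprime-* yx-coprime yx-coprime)))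
    y≈1 : y ≈ one
    y≈1 = squareDivisor-trivial (MonicQuotient.h y-monic) h' (MonicQuotient.eq y-monic) sfh' (coprime-divides squares-coprime (≈-sym δ²-cancelled))
    x≈1 : x ≈ one
    x≈1 = squareDivisor-trivial (MonicQuotient.h x-monic) h (MonicQuotient.eq x-monic) sfh (coprime-divides (coprime-sym squares-coprime) δ²-cancelled)

  eval : Poly → F → F
  eval [] x = 0#
  eval (a ∷ f) x = a ⊕ (x ⊗ eval f x)

  eval-zero : ∀ f x → IsZero f → eval f x ≡ 0#
  eval-zero [] x z = refl
  eval-zero (a ∷ f) x (a0 , z) = begin
    a ⊕ (x ⊗ eval f x) ≡⟨ cong₂ (λ u v → u ⊕ (x ⊗ v)) a0 (eval-zero f x z) ⟩
    0# ⊕ (x ⊗ 0#) ≡⟨ +-identityˡ _ ⟩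
    x ⊗ 0# ≡⟨ zeroʳ x ⟩
    0# ∎

  eval-cong : ∀ {f g} x → f ≈ g → eval f x ≡ eval g x
  eval-cong {g = g} x ([]≈ z) = sym (eval-zero g x z)
  eval-cong {f = f} x (≈[] z) = eval-zero f x z
  eval-cong x (∷≈ p e) = cong₂ (λ u v → u ⊕ (x ⊗ v)) p (eval-cong x e)

  eval-+ : ∀ f g x → eval (f +ₚ g) x ≡ eval f x ⊕ eval g x
  eval-+ [] g x = sym (+-identityˡ _)
  eval-+ (a ∷ f) [] x = sym (+-identityʳ _)
  eval-+ (a ∷ f) (b ∷ g) x = begin
    (a ⊕ b) ⊕ (x ⊗ eval (f +ₚ g) x) ≡⟨ cong (λ t → (a ⊕ b) ⊕ (x ⊗ t)) (eval-+ f g x) ⟩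
    (a ⊕ b) ⊕ (x ⊗ (eval f x ⊕ eval g x)) ≡⟨ cong ((a ⊕ b) ⊕_) (distribˡ x _ _) ⟩
    (a ⊕ b) ⊕ ((x ⊗ eval f x) ⊕ (x ⊗ eval g x)) ≡⟨ F+CS.interchange a b _ _ ⟩
    (a ⊕ (x ⊗ eval f x)) ⊕ (b ⊕ (x ⊗ eval g x)) ∎

  eval-scale : ∀ c f x → eval (scale c f) x ≡ c ⊗ eval f x
  eval-scale c [] x = sym (zeroʳ c)
  eval-scale c (a ∷ f) x = begin
    (c ⊗ a) ⊕ (x ⊗ eval (scale c f) x) ≡⟨ cong (λ t → (c ⊗ a) ⊕ (x ⊗ t)) (eval-scale c f x) ⟩
    (c ⊗ a) ⊕ (x ⊗ (c ⊗ eval f x)) ≡⟨ cong ((c ⊗ a) ⊕_) (F*CS.x∙yz≈y∙xz x c _) ⟩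
    (c ⊗ a) ⊕ (c ⊗ (x ⊗ eval f x)) ≡⟨ sym (distribˡ c _ _) ⟩
    c ⊗ (a ⊕ (x ⊗ eval f x)) ∎

  eval-* : ∀ f g x → eval (f *ₚ g) x ≡ eval f x ⊗ eval g x
  eval-* [] g x = sym (zeroˡ _)
  eval-* (a ∷ f) g x = begin
    eval (scale a g +ₚ (0# ∷ f *ₚ g)) x ≡⟨ eval-+ (scale a g) _ x ⟩
    eval (scale a g) x ⊕ (0# ⊕ (x ⊗ eval (f *ₚ g) x)) ≡⟨ cong₂ _⊕_ (eval-scale a g x) (trans (+-identityˡ _) (cong (x ⊗_) (eval-* f g x))) ⟩
    (a ⊗ eval g x) ⊕ (x ⊗ (eval f x ⊗ eval g x)) ≡⟨ cong ((a ⊗ eval g x) ⊕_) (sym (*-assoc x _ _)) ⟩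
    (a ⊗ eval g x) ⊕ ((x ⊗ eval f x) ⊗ eval g x) ≡⟨ sym (distribʳ (eval g x) a _) ⟩
    (a ⊕ (x ⊗ eval f x)) ⊗ eval g x ∎

  linear : F → Vec F 1
  linear c = ⊖ c ∷ᵥ []ᵥ

  eval-linear : ∀ c x → eval (monic (linear c)) x ≡ x ⊕ (⊖ c)
  eval-linear c x = begin
    (⊖ c) ⊕ (x ⊗ (1# ⊕ (x ⊗ 0#))) ≡⟨ cong (λ t → (⊖ c) ⊕ (x ⊗ (1# ⊕ t))) (zeroʳ x) ⟩
    (⊖ c) ⊕ (x ⊗ (1# ⊕ 0#)) ≡⟨ cong (λ t → (⊖ c) ⊕ (x ⊗ t)) (+-identityʳ 1#) ⟩
    (⊖ c) ⊕ (x ⊗ 1#) ≡⟨ cong ((⊖ c) ⊕_) (*-identityʳ x) ⟩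
    (⊖ c) ⊕ x ≡⟨ +-comm _ x ⟩
    x ⊕ (⊖ c) ∎

  eval-linear-root : ∀ c → eval (monic (linear c)) c ≡ 0#
  eval-linear-root c = trans (eval-linear c c) (-‿inverseʳ c)

  eval-one : ∀ x → eval (monic []ᵥ) x ≡ 1#
  eval-one x = trans (cong (1# ⊕_) (zeroʳ x)) (+-identityʳ 1#)

  mulLinear : ∀ {n} → F → Vec F n → Vec F (suc n)
  mulLinear c g = proj₁ (mul-monic (linear c) g)

  mulLinear-eq : ∀ {n} c (g : Vec F n) → monic (linear c) *ₚ monic g ≡ monic (mulLinear c g)
  mulLinear-eq c g = proj₂ (mul-monic (linear c) g)

  eval-mulLinear : ∀ {n} c (g : Vec F n) x → eval (monic (mulLinear c g)) x ≡ (x ⊕ (⊖ c)) ⊗ eval (monic g) x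
  eval-mulLinear c g x = trans (cong (λ t → eval t x) (sym (mulLinear-eq c g))) (trans (eval-* (monic (linear c)) (monic g) x) (cong (_⊗ eval (monic g) x) (eval-linear c x)))

  mulLinear-inj : ∀ {n} c (g g' : Vec F n) → mulLinear c g ≡ mulLinear c g' → g ≡ g'
  mulLinear-inj c g g' e = monic-inj g g' (monic-cancel (linear c) (monic g) (monic g') (≡⇒≈ (trans (mulLinear-eq c g) (trans (cong monic e) (sym (mulLinear-eq c g'))))))

  factor-theorem : ∀ {k} c (v : Vec F k) → eval (monic v) c ≡ 0# → Σ[ u ∈ Vec F (k ∸ 1) ] monic (linear c) *ₚ monic u ≈ monic v
  factor-theorem {zero} c []ᵥ e = ⊥-elim (1≢0 (trans (sym (eval-one c)) e))
  factor-theorem {suc k} c v e with divide (linear c) (monic v)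
  ... | q , (r ∷ᵥ []ᵥ) , eq = MonicQuotient.h mq , ≈-trans (*ₚ-congˡ (monic (linear c)) (≈-sym (MonicQuotient.eq mq))) quotient-eq
    where
    remainder-zero : r ≡ 0#
    remainder-zero = begin
      r ≡⟨ sym (+-identityˡ r) ⟩
      0# ⊕ r ≡⟨ cong (_⊕ r) (sym (zeroˡ (eval q c))) ⟩
      (0# ⊗ eval q c) ⊕ r ≡⟨ cong (λ t → (t ⊗ eval q c) ⊕ r) (sym (eval-linear-root c)) ⟩
      (eval (monic (linear c)) c ⊗ eval q c) ⊕ r ≡⟨ cong (_ ⊕_) (sym (trans (cong (r ⊕_) (zeroʳ c)) (+-identityʳ r))) ⟩
      (eval (monic (linear c)) c ⊗ eval q c) ⊕ eval (r ∷ []) c ≡⟨ cong (_⊕ eval (r ∷ []) c) (sym (eval-* (monic (linear c)) q c)) ⟩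
      eval (monic (linear c) *ₚ q) c ⊕ eval (r ∷ []) c ≡⟨ sym (eval-+ (monic (linear c) *ₚ q) (r ∷ []) c) ⟩
      eval (monic (linear c) *ₚ q +ₚ (r ∷ [])) c ≡⟨ sym (eval-cong c eq) ⟩
      eval (monic v) c ≡⟨ e ⟩
      0# ∎
    quotient-eq : monic (linear c) *ₚ q ≈ monic v
    quotient-eq = ≈-sym (≈-trans eq (+ₚ-zeroʳ _ (r ∷ []) (remainder-zero , tt)))
    mq : MonicQuotient 1 (suc k) q
    mq = quot-monic (linear c) v q quotient-eq

  mulLinear≈ : ∀ {n} c (g : Vec F n) → monic (mulLinear c g) ≈ monic (linear c) *ₚ monic g
  mulLinear≈ c g = ≡⇒≈ (sym (mulLinear-eq c g))

  mulLinear-root : ∀ {n} c (g : Vec F n) → eval (monic (mulLinear c g)) c ≡ 0#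
  mulLinear-root c g = trans (eval-mulLinear c g c) (trans (cong (_⊗ eval (monic g) c) (-‿inverseʳ c)) (zeroˡ _))

  SF-mulLinear⇒SF : ∀ {n} c (g : Vec F n) → SF (mulLinear c g) → SF g
  SF-mulLinear⇒SF c g sf h x e = sf h (monic (linear c) *ₚ x)
    (≈-trans (*CS.x∙yz≈y∙xz (monic h *ₚ monic h) (monic (linear c)) x) (≈-trans (*ₚ-congˡ (monic (linear c)) e) (≈-sym (mulLinear≈ c g))))

  SF-mulLinear⇒nonroot : ∀ {n} c (g : Vec F n) → SF (mulLinear c g) → eval (monic g) c ≢ 0#
  SF-mulLinear⇒nonroot c g sf e0 with factor-theorem c g e0
  ... | u , eu = sf (linear c) (monic u) (beginₚ
    (L *ₚ L) *ₚ monic u ≈⟨ *ₚ-assoc L L (monic u) ⟩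
    L *ₚ (L *ₚ monic u) ≈⟨ *ₚ-congˡ L eu ⟩
    L *ₚ monic g ≈⟨ ≈-sym (mulLinear≈ c g) ⟩
    monic (mulLinear c g) ∎ₚ)
    where L = monic (linear c)

  -- If h(c) = 0 and h² x ≈ (T - c) g, then g(c) = 0: writing h = (T - c) h₁ and
  -- cancelling T - c leaves g ≈ h₁² (T - c) x.
  rootSquare∣mulLinear⇒root : ∀ {n j} c (g : Vec F n) (h : Vec F (suc j)) x → eval (monic h) c ≡ 0# →
    (monic h *ₚ monic h) *ₚ x ≈ monic (mulLinear c g) → eval (monic g) c ≡ 0#
  rootSquare∣mulLinear⇒root c g h x h0 e with factor-theorem c h h0
  ... | h₁ , eh₁ = begin
      eval (monic g) c                                         ≡⟨ sym (eval-cong c cancelled) ⟩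
      eval ((monic h₁ *ₚ monic h₁) *ₚ (L *ₚ x)) c              ≡⟨ eval-* (monic h₁ *ₚ monic h₁) _ c ⟩
      eval (monic h₁ *ₚ monic h₁) c ⊗ eval (L *ₚ x) c          ≡⟨ cong (eval (monic h₁ *ₚ monic h₁) c ⊗_) L·x-root ⟩
      eval (monic h₁ *ₚ monic h₁) c ⊗ 0#                       ≡⟨ zeroʳ _ ⟩
      0#                                                       ∎
    where
    L = monic (linear c)
    L·x-root : eval (L *ₚ x) c ≡ 0#
    L·x-root = trans (eval-* L x c) (trans (cong (_⊗ eval x c) (eval-linear-root c)) (zeroˡ _))
    cancelled : (monic h₁ *ₚ monic h₁) *ₚ (L *ₚ x) ≈ monic g
    cancelled = monic-cancel (linear c) _ _ (beginₚ
      L *ₚ ((monic h₁ *ₚ monic h₁) *ₚ (L *ₚ x)) ≈⟨ *ₚ-congˡ L (*CS.x∙yz≈y∙xz (monic h₁ *ₚ monic h₁) L x) ⟩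
      L *ₚ (L *ₚ ((monic h₁ *ₚ monic h₁) *ₚ x)) ≈⟨ ≈-sym (square-assoc L (monic h₁) x) ⟩
      ((L *ₚ monic h₁) *ₚ (L *ₚ monic h₁)) *ₚ x ≈⟨ *ₚ-congʳ x (*ₚ-cong eh₁ eh₁) ⟩
      (monic h *ₚ monic h) *ₚ x                 ≈⟨ e ⟩
      monic (mulLinear c g)                     ≈⟨ mulLinear≈ c g ⟩
      L *ₚ monic g                              ∎ₚ)

  -- If h(c) ≠ 0 and h² x ≈ (T - c) g, then x(c) = 0, so x = (T - c) x₁ and h² divides g.
  nonrootSquare∣mulLinear⇒∣ : ∀ {n j} c (g : Vec F n) (h : Vec F (suc j)) x → eval (monic h) c ≢ 0# →
    (monic h *ₚ monic h) *ₚ x ≈ monic (mulLinear c g) → Σ[ x₁ ∈ Poly ] (monic h *ₚ monic h) *ₚ x₁ ≈ monic g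
  nonrootSquare∣mulLinear⇒∣ c g h x h≢0 e with mul-monic h h
  ... | w , we = divides (quot-monic w (mulLinear c g) x (≈-trans (≡⇒≈ (sym (cong (_*ₚ x) we))) e))
    where
    L = monic (linear c)
    x-root : eval x c ≡ 0#
    x-root with no-zero-divisors (eval (monic h *ₚ monic h) c) (eval x c)
                  (trans (sym (eval-* (monic h *ₚ monic h) x c)) (trans (eval-cong c e) (mulLinear-root c g)))
    ... | inj₂ p = p
    ... | inj₁ p with no-zero-divisors (eval (monic h) c) (eval (monic h) c) (trans (sym (eval-* (monic h) (monic h) c)) p)
    ...   | inj₁ q = ⊥-elim (h≢0 q)
    ...   | inj₂ q = ⊥-elim (h≢0 q)
    divides : MonicQuotient _ _ x → Σ[ x₁ ∈ Poly ] (monic h *ₚ monic h) *ₚ x₁ ≈ monic g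
    divides (monicQuotient _ xv xeq) with factor-theorem c xv (trans (sym (eval-cong c xeq)) x-root)
    ... | xu , exu = monic xu , monic-cancel (linear c) _ _ (beginₚ
      L *ₚ ((monic h *ₚ monic h) *ₚ monic xu) ≈⟨ *CS.x∙yz≈y∙xz L (monic h *ₚ monic h) (monic xu) ⟩
      (monic h *ₚ monic h) *ₚ (L *ₚ monic xu) ≈⟨ *ₚ-congˡ (monic h *ₚ monic h) (≈-trans exu (≈-sym xeq)) ⟩
      (monic h *ₚ monic h) *ₚ x               ≈⟨ e ⟩
      monic (mulLinear c g)                   ≈⟨ mulLinear≈ c g ⟩
      L *ₚ monic g                            ∎ₚ)

  SF-mulLinear : ∀ {n} c (g : Vec F n) → SF g → eval (monic g) c ≢ 0# → SF (mulLinear c g)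
  SF-mulLinear c g sfg g≢0 h x e with eval (monic h) c ≟ 0#
  ... | yes h0 = g≢0 (rootSquare∣mulLinear⇒root c g h x h0 e)
  ... | no h≢0 = let (x₁ , e₁) = nonrootSquare∣mulLinear⇒∣ c g h x h≢0 e in sfg h x₁ e₁

module Counting (K : FiniteField) where
  open import Data.Nat using (ℕ; zero; suc; _+_; _*_; _^_; _∸_; _≤_; _<_; z≤n; s≤s; _≤ᵇ_)
  open ListCounting
  open Polynomials K
  open Eq.≡-Reasoning

  monics : (n : ℕ) → List (Vec F n)
  monics = D.allMonic K

  q : ℕ
  q = D.order K

  isSquarefree : ∀ {n} → Vec F n → Bool
  isSquarefree = D.squarefree K

  isRoot : ∀ {n} → Vec F n → F → Bool
  isRoot f c = does (eval (monic f) c ≟ 0#)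

  ∧-intro : ∀ {a b} → a ≡ true → b ≡ true → (a ∧ b) ≡ true
  ∧-intro refl refl = refl

  ∧-l : ∀ {a b} → (a ∧ b) ≡ true → a ≡ true
  ∧-l {true} _ = refl

  ∧-r : ∀ {a b} → (a ∧ b) ≡ true → b ≡ true
  ∧-r {true} e = e

  ≤ᵇ≡true⇒≤ : ∀ {m n} → (m ≤ᵇ n) ≡ true → m ≤ n
  ≤ᵇ≡true⇒≤ {m} {n} e = NP.≤ᵇ⇒≤ m n (Function.Bundles.Equivalence.from BP.T-≡ e)

  ≤⇒≤ᵇ≡true : ∀ {m n} → m ≤ n → (m ≤ᵇ n) ≡ true
  ≤⇒≤ᵇ≡true le = Function.Bundles.Equivalence.to BP.T-≡ (NP.≤⇒≤ᵇ le)

  isRoot⇒ : ∀ {n} (f : Vec F n) c → isRoot f c ≡ true → eval (monic f) c ≡ 0#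
  isRoot⇒ f c e with eval (monic f) c ≟ 0#
  ... | yes p = p

  ⇒isRoot : ∀ {n} (f : Vec F n) c → eval (monic f) c ≡ 0# → isRoot f c ≡ true
  ⇒isRoot f c e with eval (monic f) c ≟ 0#
  ... | yes p = refl
  ... | no ¬p = ⊥-elim (¬p e)

  notRoot⇒ : ∀ {n} (f : Vec F n) c → not (isRoot f c) ≡ true → eval (monic f) c ≢ 0#
  notRoot⇒ f c e with eval (monic f) c ≟ 0#
  ... | no ¬p = ¬p

  ⇒notRoot : ∀ {n} (f : Vec F n) c → eval (monic f) c ≢ 0# → not (isRoot f c) ≡ true
  ⇒notRoot f c e with eval (monic f) c ≟ 0#
  ... | yes p = ⊥-elim (e p)
  ... | no ¬p = refl

  monics-complete : ∀ {n} (v : Vec F n) → v ∈ monics n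
  monics-complete []ᵥ = here refl
  monics-complete {suc n} (x ∷ᵥ v) = ∈-concatMap⁺ (λ y → map (y ∷ᵥ_) (monics n)) (elems-complete x) (∈-map⁺ (x ∷ᵥ_) (monics-complete v))

  monics-unique : ∀ n → Unique (monics n)
  monics-unique zero = [] ∷ []
  monics-unique (suc n) = Unique-concatMap (λ y → map (y ∷ᵥ_) (monics n)) elems-unique
    (λ x → UP.map⁺ (λ { refl → refl }) (monics-unique n))
    λ p r → let (u , _ , e1) = ∈-map⁻ _ p ; (w , _ , e2) = ∈-map⁻ _ r in
      VP.∷-injectiveˡ (trans (sym e1) e2)

  monics-length : ∀ n → length (monics n) ≡ q ^ n
  monics-length zero = refl
  monics-length (suc n) = trans (length-concatMap (λ y → map (y ∷ᵥ_) (monics n)) elems)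
    (trans (cong sum (map-cong (λ x → trans (length-map (x ∷ᵥ_) (monics n)) (monics-length n)) elems))
      (sum-const (q ^ n) elems))

  monic≈⇒≡ : ∀ {a b} (u : Vec F a) (v : Vec F b) → monic u ≈ monic v → monic u ≡ monic v
  monic≈⇒≡ u v e = cong (_++ [ 1# ]) (proj₁ (lead-≈ (toList u) (toList v) 1# 1# 1≢0 1≢0 e))

  ==⇒ : ∀ (xs ys : Poly) → D._==_ K xs ys ≡ true → xs ≡ ys
  ==⇒ xs ys e with ≡-dec _≟_ xs ys
  ... | yes p = p

  ⇒== : ∀ (xs ys : Poly) → xs ≡ ys → D._==_ K xs ys ≡ true
  ⇒== xs ys e with ≡-dec _≟_ xs ys
  ... | yes p = refl
  ... | no ¬p = ⊥-elim (¬p e)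

  dividesWith⇒ : ∀ p k (f : Poly) → D.dividesWith K p k f ≡ true → Σ[ h ∈ Vec F k ] p *ₚ monic h ≡ f
  dividesWith⇒ p k f e = let (h , _ , e') = any⁻ _ (monics k) e in h , ==⇒ _ _ e'

  ⇒dividesWith : ∀ p k (f : Poly) (h : Vec F k) → p *ₚ monic h ≡ f → D.dividesWith K p k f ≡ true
  ⇒dividesWith p k f h e = any⁺ _ (monics-complete h) (⇒== _ _ e)

  squareDivides : ∀ {n} (f : Vec F n) d → Vec F d → Bool
  squareDivides {n} f d g = D.dividesWith K (monic g *ₚ monic g) (n ∸ (d + d)) (monic f)

  hasSquareOfDegree : ∀ {n} (f : Vec F n) → ℕ → Bool
  hasSquareOfDegree {n} f d = ((d + d) ≤ᵇ n) ∧ any (squareDivides f d) (monics d)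

  SF⇒isSquarefree : ∀ {n} (f : Vec F n) → SF f → isSquarefree f ≡ true
  SF⇒isSquarefree {n} f sf with any (hasSquareOfDegree f) (map suc (upTo n)) in eq
  ... | false = refl
  ... | true with any⁻ (hasSquareOfDegree f) (map suc (upTo n)) eq
  ... | d , d∈ , Pd with ∈-map⁻ suc d∈
  ... | j , _ , refl with any⁻ (squareDivides f (suc j)) (monics (suc j)) (∧-r {(suc j + suc j) ≤ᵇ n} Pd)
  ... | g , _ , dv with dividesWith⇒ (monic g *ₚ monic g) (n ∸ (suc j + suc j)) (monic f) dv
  ... | h , e = ⊥-elim (sf g (monic h) (≡⇒≈ {(monic g *ₚ monic g) *ₚ monic h} e))

  isSquarefree⇒SF : ∀ {n} (f : Vec F n) → isSquarefree f ≡ true → SF f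
  isSquarefree⇒SF {n} f s {j} g x e with mul-monic g g
  ... | w , we with quot-monic w f x (≈-trans (*ₚ-congʳ x (≡⇒≈ (sym we))) e)
  ... | monicQuotient d≤n h xeq = contra s
    where
    d = suc j
    prodEq : (monic g *ₚ monic g) *ₚ monic h ≡ monic f
    prodEq = trans (cong (_*ₚ monic h) we) (trans (proj₂ (mul-monic w h)) (monic≈⇒≡ (proj₁ (mul-monic w h)) f
      (≈-trans (≡⇒≈ (sym (proj₂ (mul-monic w h)))) (≈-trans (*ₚ-congʳ (monic h) (≡⇒≈ (sym we))) (≈-trans (*ₚ-congˡ (monic g *ₚ monic g) (≈-sym xeq)) e)))))
    j<n : j < n
    j<n = NP.<-≤-trans (s≤s (NP.m≤m+n j (suc j))) d≤n
    anyT : any (hasSquareOfDegree f) (map suc (upTo n)) ≡ true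
    anyT = any⁺ (hasSquareOfDegree f) (∈-map⁺ suc (∈-applyUpTo⁺ (λ i → i) j<n))
      (∧-intro (≤⇒≤ᵇ≡true d≤n) (any⁺ (squareDivides f d) (monics-complete g) (⇒dividesWith (monic g *ₚ monic g) _ (monic f) h prodEq)))
    contra : isSquarefree f ≡ true → ⊥
    contra s' with trans (sym s') (cong not anyT)
    ... | ()

  linearDivides≡isRoot : ∀ {n} a (f : Vec F n) → D.linearDivides K a f ≡ isRoot f a
  linearDivides≡isRoot {n} a f with eval (monic f) a ≟ 0#
  ... | yes e with factor-theorem a f e
  ... | u , eu = ⇒dividesWith (monic (linear a)) (n ∸ 1) (monic f) u (trans (mulLinear-eq a u) (monic≈⇒≡ (mulLinear a u) f (≈-trans (mulLinear≈ a u) eu)))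
  linearDivides≡isRoot {n} a f | no ne with D.linearDivides K a f in eq
  ... | false = refl
  ... | true with dividesWith⇒ (monic (linear a)) (n ∸ 1) (monic f) eq
  ... | h , eh = ⊥-elim (ne (trans (cong (λ t → eval t a) (sym eh)) (trans (eval-* (monic (linear a)) (monic h) a) (trans (cong (_⊗ eval (monic h) a) (eval-linear-root a)) (zeroˡ _)))))

  const0≡eval : ∀ {n} (f : Vec F n) → D.const0 K f ≡ eval (monic f) 0#
  const0≡eval []ᵥ = sym (trans (cong (1# ⊕_) (zeroˡ _)) (+-identityʳ 1#))
  const0≡eval (x ∷ᵥ f) = sym (trans (cong (x ⊕_) (zeroˡ _)) (+-identityʳ x))

  nonzeroConst≡ : ∀ {n} (f : Vec F n) → D.nonzeroConst K f ≡ not (isRoot f 0#)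
  nonzeroConst≡ f = cong (λ t → not (does (t ≟ 0#))) (const0≡eval f)

  -- Multiplication by T - c is a bijection from the squarefree g of degree m with
  -- g(c) ≠ 0 onto the squarefree f of degree m + 1 with f(c) = 0; it also preserves
  -- any property P that is invariant under it.
  module _ (c : F) (P : ∀ {m} → Vec F m → Bool) (Pinv : ∀ {m} (g : Vec F m) → P (mulLinear c g) ≡ P g) where
    rootWithP : ∀ {m} → Vec F m → Bool
    rootWithP f = (isSquarefree f ∧ P f) ∧ isRoot f c
    nonrootWithP : ∀ {m} → Vec F m → Bool
    nonrootWithP g = (isSquarefree g ∧ P g) ∧ not (isRoot g c)

    mulLinear-rootWithP : ∀ {m} (u : Vec F m) → nonrootWithP u ≡ true → rootWithP (mulLinear c u) ≡ true
    mulLinear-rootWithP u e = ∧-intro (∧-intro (SF⇒isSquarefree (mulLinear c u) (SF-mulLinear c u (isSquarefree⇒SF u (∧-l (∧-l e))) (notRoot⇒ u c (∧-r e))))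
                                    (trans (Pinv u) (∧-r (∧-l {isSquarefree u ∧ P u} e))))
                          (⇒isRoot (mulLinear c u) c (mulLinear-root c u))

    rootWithP⇒mulLinear : ∀ {m} (z : Vec F (suc m)) → rootWithP z ≡ true → Σ[ u ∈ Vec F m ] z ≡ mulLinear c u × nonrootWithP u ≡ true
    rootWithP⇒mulLinear z e with factor-theorem c z (isRoot⇒ z c (∧-r e))
    ... | u , eu = u , zeq ,
      ∧-intro (∧-intro (SF⇒isSquarefree u (SF-mulLinear⇒SF c u sfl))
                       (trans (sym (Pinv u)) (subst (λ t → P t ≡ true) zeq (∧-r (∧-l {isSquarefree z ∧ P z} e)))))
                    (⇒notRoot u c (SF-mulLinear⇒nonroot c u sfl))
      where
      zeq : z ≡ mulLinear c u
      zeq = sym (monic-inj (mulLinear c u) z (≈-trans (mulLinear≈ c u) eu))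
      sfl : SF (mulLinear c u)
      sfl = subst SF zeq (isSquarefree⇒SF z (∧-l (∧-l e)))

    rootWithP-count : ∀ m → length (filterᵇ rootWithP (monics (suc m))) ≡ length (filterᵇ nonrootWithP (monics m))
    rootWithP-count m = trans
      (unique-≋⇒length≡ (Unique-filterᵇ rootWithP (monics-unique (suc m)))
        (UP.map⁺ (λ {x} {y} → mulLinear-inj c x y) (Unique-filterᵇ nonrootWithP (monics-unique m))) forward backward)
      (length-map (mulLinear c) (filterᵇ nonrootWithP (monics m)))
      where
      forward : ∀ {z} → z ∈ filterᵇ rootWithP (monics (suc m)) → z ∈ map (mulLinear c) (filterᵇ nonrootWithP (monics m))
      forward {z} z∈ with rootWithP⇒mulLinear z (proj₂ (∈-filterᵇ⁻ rootWithP (monics (suc m)) z∈))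
      ... | u , refl , pu = ∈-map⁺ (mulLinear c) (∈-filterᵇ⁺ nonrootWithP (monics m) (monics-complete u) pu)
      backward : ∀ {z} → z ∈ map (mulLinear c) (filterᵇ nonrootWithP (monics m)) → z ∈ filterᵇ rootWithP (monics (suc m))
      backward z∈ with ∈-map⁻ (mulLinear c) z∈
      ... | u , u∈ , refl = ∈-filterᵇ⁺ rootWithP (monics (suc m)) (monics-complete _) (mulLinear-rootWithP u (proj₂ (∈-filterᵇ⁻ nonrootWithP (monics m) u∈)))

  -- The counting functions: S(n) squarefree monics of degree n, A(n) = |𝒴_n| (also
  -- f(0) ≠ 0), and B_c(n) those of 𝒴_n with moreover f(c) ≠ 0.
  sqfCount : ℕ → ℕ
  sqfCount n = length (filterᵇ isSquarefree (monics n))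

  unitConst : ∀ {m} → Vec F m → Bool
  unitConst f = not (isRoot f 0#)

  𝒴Count : ℕ → ℕ
  𝒴Count n = length (filterᵇ (λ f → isSquarefree f ∧ unitConst f) (monics n))

  avoidCount : F → ℕ → ℕ
  avoidCount c n = length (filterᵇ (λ f → (isSquarefree f ∧ unitConst f) ∧ not (isRoot f c)) (monics n))

  -- S(m+1) = A(m+1) + A(m): a squarefree f with f(0) = 0 is T · g with g ∈ 𝒴_m.
  sqfCount-split : ∀ m → sqfCount (suc m) ≡ 𝒴Count (suc m) + 𝒴Count m
  sqfCount-split m = trans (filter-split isSquarefree unitConst (monics (suc m)))
    (cong (𝒴Count (suc m) +_) (trans (cong length (filter-ext _ _ (monics (suc m)) (λ f → root-at-0 f)))
      (trans (rootWithP-count 0# (λ _ → true) (λ _ → refl) m) (cong length (filter-ext _ _ (monics m) (λ f → cong (_∧ unitConst f) (BP.∧-identityʳ (isSquarefree f))))))))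
    where
    root-at-0 : ∀ f → (isSquarefree f ∧ not (unitConst f)) ≡ ((isSquarefree f ∧ true) ∧ isRoot f 0#)
    root-at-0 f = trans (cong (isSquarefree f ∧_) (BP.not-involutive (isRoot f 0#))) (cong (_∧ isRoot f 0#) (sym (BP.∧-identityʳ (isSquarefree f))))

  -- (T - c)(0) = -c ≠ 0 for c ≠ 0, so multiplying by T - c does not change
  -- whether 0 is a root.
  neg≢0 : ∀ c → c ≢ 0# → (0# ⊕ (⊖ c)) ≢ 0#
  neg≢0 c c≢0 e = c≢0 (trans (sym (-‿involutive c)) (trans (cong ⊖_ (trans (sym (+-identityˡ (⊖ c))) e)) -0#≈0#))

  mulLinear-root0 : ∀ {m} c (g : Vec F m) → c ≢ 0# → isRoot (mulLinear c g) 0# ≡ isRoot g 0#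
  mulLinear-root0 c g c≢0 with eval (monic g) 0# ≟ 0#
  ... | yes e = ⇒isRoot (mulLinear c g) 0# (trans (eval-mulLinear c g 0#) (trans (cong (_ ⊗_) e) (zeroʳ _)))
  ... | no ne with eval (monic (mulLinear c g)) 0# ≟ 0#
  ...   | no _ = refl
  ...   | yes e with no-zero-divisors _ _ (trans (sym (eval-mulLinear c g 0#)) e)
  ...     | inj₁ p = ⊥-elim (neg≢0 c c≢0 p)
  ...     | inj₂ p = ⊥-elim (ne p)

  -- For c ≠ 0: A(m+1) = B_c(m+1) + B_c(m), splitting 𝒴_{m+1} by whether f(c) = 0.
  𝒴Count-split : ∀ c → c ≢ 0# → ∀ m → 𝒴Count (suc m) ≡ avoidCount c (suc m) + avoidCount c m
  𝒴Count-split c c≢0 m = trans (filter-split (λ f → isSquarefree f ∧ unitConst f) (λ f → not (isRoot f c)) (monics (suc m)))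
    (cong (avoidCount c (suc m) +_) (trans (cong length (filter-ext _ _ (monics (suc m)) (λ f → cong ((isSquarefree f ∧ unitConst f) ∧_) (BP.not-involutive (isRoot f c)))))
      (rootWithP-count c unitConst (λ g → cong not (mulLinear-root0 c g c≢0)) m)))

  rootCount : F → ℕ → ℕ
  rootCount a n = length (filterᵇ (λ f → D.linearDivides K a f) (D.𝒴 K n))

  rootCount-eq : ∀ a n → rootCount a n ≡ length (filterᵇ (λ f → (isSquarefree f ∧ unitConst f) ∧ isRoot f a) (monics n))
  rootCount-eq a n = cong length (trans (filter-filter _ _ (monics n))
    (filter-ext _ _ (monics n) λ f → cong₂ _∧_ (cong (isSquarefree f ∧_) (nonzeroConst≡ f)) (linearDivides≡isRoot a f)))

  rootCount-nonzero : ∀ a → a ≢ 0# → ∀ m → rootCount a (suc m) ≡ avoidCount a m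
  rootCount-nonzero a a≢0 m = trans (rootCount-eq a (suc m)) (rootWithP-count a unitConst (λ g → cong not (mulLinear-root0 a g a≢0)) m)

  rootCount-zero : ∀ n → rootCount 0# n ≡ 0
  rootCount-zero n = trans (rootCount-eq 0# n) (filter-none _ (monics n) λ f → contradictory (isSquarefree f) (isRoot f 0#))
    where
    contradictory : ∀ a b → (a ∧ not b) ∧ b ≡ false
    contradictory false b = refl
    contradictory true false = refl
    contradictory true true = refl

  -- The square decomposition f = g² h with h squarefree, which exists (by peeling off
  -- squares) and is unique (squarePart-unique); it yields q^n = Σ_d q^d · S(n - 2d).
  sqTimes : ∀ {d k} → Vec F d → Vec F k → Poly
  sqTimes g h = (monic g *ₚ monic g) *ₚ monic h

  sqTimes-monic : ∀ {d k} (g : Vec F d) (h : Vec F k) → Σ[ w ∈ Vec F (d + d + k) ] sqTimes g h ≡ monic w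
  sqTimes-monic g h with mul-monic g g
  ... | w , we with mul-monic w h
  ... | w' , we' = w' , trans (cong (_*ₚ monic h) we) we'

  notSquarefree⇒square : ∀ {n} (v : Vec F n) → isSquarefree v ≡ false →
    Σ[ j ∈ ℕ ] Σ[ g ∈ Vec F (suc j) ] Σ[ h ∈ Vec F (n ∸ (suc j + suc j)) ] (suc j + suc j ≤ n) × sqTimes g h ≡ monic v
  notSquarefree⇒square {n} v e with any (hasSquareOfDegree v) (map suc (upTo n)) in eq
  ... | false = ⊥-elim (true≢false e)
    where
    true≢false : true ≢ false
    true≢false ()
  ... | true with any⁻ (hasSquareOfDegree v) (map suc (upTo n)) eq
  ... | d , d∈ , Pd with ∈-map⁻ suc d∈
  ... | j , _ , refl with any⁻ (squareDivides v (suc j)) (monics (suc j)) (∧-r {(suc j + suc j) ≤ᵇ n} Pd)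
  ... | g , _ , dv with dividesWith⇒ (monic g *ₚ monic g) (n ∸ (suc j + suc j)) (monic v) dv
  ... | h , eh = j , g , h , ≤ᵇ≡true⇒≤ (∧-l Pd) , eh

  record SquareDecomposition {n} (v : Vec F n) : Set where
    constructor squareDecomposition
    field
      d k : ℕ
      g : Vec F d
      h : Vec F k
      sf : SF h
      eq : sqTimes g h ≈ monic v

  square-rearrange : ∀ a b c → ((a *ₚ b) *ₚ (a *ₚ b)) *ₚ c ≈ (a *ₚ a) *ₚ ((b *ₚ b) *ₚ c)
  square-rearrange a b c = ≈-trans (*ₚ-congʳ c (*CS.interchange a b a b)) (*ₚ-assoc (a *ₚ a) (b *ₚ b) c)

  decomposeFuel : ∀ fuel {n} → n < fuel → (v : Vec F n) → SquareDecomposition v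
  decomposeFuel (suc fuel) {n} (s≤s n≤) v with isSquarefree v in e
  ... | true = squareDecomposition 0 n []ᵥ v (isSquarefree⇒SF v e) (≈-trans (*ₚ-congʳ (monic v) (*ₚ-identityˡ one)) (*ₚ-identityˡ (monic v)))
  ... | false with notSquarefree⇒square v e
  ... | j , g , h , le , eh with decomposeFuel fuel (NP.≤-trans (NP.∸-monoʳ-< {n} {suc j + suc j} {0} (s≤s z≤n) le) n≤) h
  ... | squareDecomposition d' k' g' h' sf' eq' with mul-monic g g'
  ... | gg , ggeq = squareDecomposition (suc j + d') k' gg h' sf' (beginₚ
    (monic gg *ₚ monic gg) *ₚ monic h' ≈⟨ *ₚ-congʳ (monic h') (≡⇒≈ (sym (cong₂ _*ₚ_ ggeq ggeq))) ⟩
    ((monic g *ₚ monic g') *ₚ (monic g *ₚ monic g')) *ₚ monic h' ≈⟨ square-rearrange (monic g) (monic g') (monic h') ⟩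
    (monic g *ₚ monic g) *ₚ ((monic g' *ₚ monic g') *ₚ monic h') ≈⟨ *ₚ-congˡ (monic g *ₚ monic g) eq' ⟩
    (monic g *ₚ monic g) *ₚ monic h ≈⟨ ≡⇒≈ eh ⟩
    monic v ∎ₚ)

  decompose : ∀ {n} (v : Vec F n) → SquareDecomposition v
  decompose {n} v = decomposeFuel (suc n) (NP.n<1+n n) v

  squarefrees : ∀ k → List (Vec F k)
  squarefrees k = filterᵇ isSquarefree (monics k)

  squareLayer : ℕ → ℕ → List Poly
  squareLayer n d = if d + d ≤ᵇ n then concatMap (λ g → map (sqTimes g) (squarefrees (n ∸ (d + d)))) (monics d) else []

  allSquareProducts : ℕ → List Poly
  allSquareProducts n = concatMap (squareLayer n) (downFrom (suc n))

  allMonicPolys : ℕ → List Poly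
  allMonicPolys n = map monic (monics n)

  squareLayer-∈ : ∀ n d {z} → z ∈ squareLayer n d → Σ[ g ∈ Vec F d ] Σ[ h ∈ Vec F (n ∸ (d + d)) ] (d + d ≤ n) × isSquarefree h ≡ true × z ≡ sqTimes g h
  squareLayer-∈ n d z∈ with d + d ≤ᵇ n in le
  ... | true with ∈-concatMap⁻ (λ g → map (sqTimes g) (squarefrees (n ∸ (d + d)))) (monics d) z∈
  ... | g , _ , z∈' with ∈-map⁻ (sqTimes g) z∈'
  ... | h , h∈ , refl = g , h , ≤ᵇ≡true⇒≤ le , proj₂ (∈-filterᵇ⁻ isSquarefree (monics _) h∈) , refl

  squareLayer-true : ∀ n d → (d + d ≤ᵇ n) ≡ true → squareLayer n d ≡ concatMap (λ g → map (sqTimes g) (squarefrees (n ∸ (d + d)))) (monics d)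
  squareLayer-true n d e rewrite e = refl

  sqTimes-squarePart : ∀ {d d' k k'} (g : Vec F d) (h : Vec F k) (g' : Vec F d') (h' : Vec F k') → isSquarefree h ≡ true → isSquarefree h' ≡ true →
    sqTimes g h ≡ sqTimes g' h' → monic g ≈ monic g'
  sqTimes-squarePart g h g' h' s s' e = squarePart-unique g h g' h' (isSquarefree⇒SF h s) (isSquarefree⇒SF h' s') (≡⇒≈ e)

  sqTimes-injʳ : ∀ {d k} (g : Vec F d) (h h' : Vec F k) → sqTimes g h ≡ sqTimes g h' → h ≡ h'
  sqTimes-injʳ g h h' e with mul-monic g g
  ... | w , we = monic-inj h h' (monic-cancel w (monic h) (monic h') (≈-trans (*ₚ-congʳ (monic h) (≡⇒≈ (sym we))) (≈-trans (≡⇒≈ e) (*ₚ-congʳ (monic h') (≡⇒≈ we)))))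

  squareLayer-unique : ∀ n d → Unique (squareLayer n d)
  squareLayer-unique n d with d + d ≤ᵇ n
  ... | false = []
  ... | true = Unique-concatMap (λ g → map (sqTimes g) (squarefrees (n ∸ (d + d)))) (monics-unique d)
    (λ g → UP.map⁺ (λ {x} {y} → sqTimes-injʳ g x y) (Unique-filterᵇ isSquarefree (monics-unique _)))
    tag
    where
    tag : ∀ {g g' z} → z ∈ map (sqTimes g) (squarefrees (n ∸ (d + d))) → z ∈ map (sqTimes g') (squarefrees (n ∸ (d + d))) → g ≡ g'
    tag {g} {g'} p r with ∈-map⁻ (sqTimes g) p | ∈-map⁻ (sqTimes g') r
    ... | h , h∈ , refl | h' , h'∈ , e = monic-inj g g'
      (sqTimes-squarePart g h g' h' (proj₂ (∈-filterᵇ⁻ isSquarefree (monics _) h∈)) (proj₂ (∈-filterᵇ⁻ isSquarefree (monics _) h'∈)) e)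

  allSquareProducts-unique : ∀ n → Unique (allSquareProducts n)
  allSquareProducts-unique n = Unique-concatMap (squareLayer n) (UP.downFrom⁺ (suc n)) (squareLayer-unique n) tag
    where
    tag : ∀ {d d' z} → z ∈ squareLayer n d → z ∈ squareLayer n d' → d ≡ d'
    tag {d} {d'} p r with squareLayer-∈ n d p | squareLayer-∈ n d' r
    ... | g , h , _ , s , refl | g' , h' , _ , s' , e = monic-degree g g' (sqTimes-squarePart g h g' h' s s' e)

  allMonicPolys-unique : ∀ n → Unique (allMonicPolys n)
  allMonicPolys-unique n = UP.map⁺ (λ {x} {y} e → monic-inj x y (≡⇒≈ e)) (monics-unique n)

  monic-subst : ∀ {k k'} (e : k ≡ k') (h : Vec F k) → monic (subst (Vec F) e h) ≡ monic h
  monic-subst refl h = refl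

  isSquarefree-subst : ∀ {k k'} (e : k ≡ k') (h : Vec F k) → isSquarefree (subst (Vec F) e h) ≡ isSquarefree h
  isSquarefree-subst refl h = refl

  allSquareProducts⊆ : ∀ n {z} → z ∈ allSquareProducts n → z ∈ allMonicPolys n
  allSquareProducts⊆ n z∈ with ∈-concatMap⁻ (squareLayer n) (downFrom (suc n)) z∈
  ... | d , _ , z∈' with squareLayer-∈ n d z∈'
  ... | g , h , le , s , refl with sqTimes-monic g h
  ... | w , we = subst (_∈ allMonicPolys n) (trans (monic-subst kn w) (sym we)) (∈-map⁺ monic (monics-complete (subst (Vec F) kn w)))
    where
    kn : d + d + (n ∸ (d + d)) ≡ n
    kn = NP.m+[n∸m]≡n le

  ⊆allSquareProducts : ∀ n {z} → z ∈ allMonicPolys n → z ∈ allSquareProducts n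
  ⊆allSquareProducts n z∈ with ∈-map⁻ monic z∈
  ... | v , _ , refl with decompose v
  ... | squareDecomposition d k g h sf eq with sqTimes-monic g h
  ... | w , we = ∈-concatMap⁺ (squareLayer n) (∈-applyDownFrom⁺ (λ i → i) (s≤s (NP.≤-trans (NP.m≤m+n d d) le)))
        (subst (_ ∈_) (sym (squareLayer-true n d (≤⇒≤ᵇ≡true le)))
          (∈-concatMap⁺ (λ g → map (sqTimes g) (squarefrees (n ∸ (d + d)))) (monics-complete g)
            (subst (_∈ map (sqTimes g) (squarefrees (n ∸ (d + d)))) decomposition-eq (∈-map⁺ (sqTimes g) (∈-filterᵇ⁺ isSquarefree (monics _) (monics-complete h') sh')))))
    where
    len : d + d + k ≡ n
    len = monic-degree w v (≈-trans (≡⇒≈ (sym we)) eq)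
    le : d + d ≤ n
    le = subst (d + d ≤_) len (NP.m≤m+n (d + d) k)
    ke : k ≡ n ∸ (d + d)
    ke = trans (sym (NP.m+n∸m≡n (d + d) k)) (cong (_∸ (d + d)) len)
    h' = subst (Vec F) ke h
    sh' : isSquarefree h' ≡ true
    sh' = trans (isSquarefree-subst ke h) (SF⇒isSquarefree h sf)
    decomposition-eq : sqTimes g h' ≡ monic v
    decomposition-eq = trans (cong (monic g *ₚ monic g *ₚ_) (monic-subst ke h)) (trans we (monic≈⇒≡ w v (≈-trans (≡⇒≈ (sym we)) eq)))

  layerSize : ℕ → ℕ → ℕ
  layerSize n d = if d + d ≤ᵇ n then q ^ d * sqfCount (n ∸ (d + d)) else 0

  squareLayer-length : ∀ n d → length (squareLayer n d) ≡ layerSize n d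
  squareLayer-length n d with d + d ≤ᵇ n
  ... | false = refl
  ... | true = begin
    length (concatMap (λ g → map (sqTimes g) (squarefrees k)) (monics d))   ≡⟨ length-concatMap (λ g → map (sqTimes g) (squarefrees k)) (monics d) ⟩
    sum (map (λ g → length (map (sqTimes g) (squarefrees k))) (monics d))   ≡⟨ cong sum (map-cong (λ g → length-map (sqTimes g) (squarefrees k)) (monics d)) ⟩
    sum (map (λ _ → sqfCount k) (monics d))                                 ≡⟨ sum-const (sqfCount k) (monics d) ⟩
    length (monics d) * sqfCount k                                          ≡⟨ cong (_* sqfCount k) (monics-length d) ⟩
    q ^ d * sqfCount k                                                      ∎
    where k = n ∸ (d + d)

  layerSum : ℕ → ℕ
  layerSum n = sum (map (layerSize n) (downFrom (suc n)))

  monics-by-squarePart : ∀ n → q ^ n ≡ layerSum n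
  monics-by-squarePart n = trans (sym (monics-length n)) (trans (sym (length-map monic (monics n)))
    (trans (sym (unique-≋⇒length≡ (allSquareProducts-unique n) (allMonicPolys-unique n) (allSquareProducts⊆ n) (⊆allSquareProducts n)))
    (trans (length-concatMap (squareLayer n) (downFrom (suc n))) (cong sum (map-cong (squareLayer-length n) (downFrom (suc n)))))))

  sumBelow : ℕ → (ℕ → ℕ) → ℕ
  sumBelow m f = sum (map f (downFrom m))

  sumBelow-shift : ∀ m f → sumBelow (suc m) f ≡ f 0 + sumBelow m (λ d → f (suc d))
  sumBelow-shift zero f = refl
  sumBelow-shift (suc m) f = trans (cong (f (suc m) +_) (sumBelow-shift m f))
    (trans (sym (NP.+-assoc (f (suc m)) (f 0) _)) (trans (cong (_+ sumBelow m (λ d → f (suc d))) (NP.+-comm (f (suc m)) (f 0))) (NP.+-assoc (f 0) _ _)))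

  sumBelow-ext : ∀ m f g → (∀ d → f d ≡ g d) → sumBelow m f ≡ sumBelow m g
  sumBelow-ext zero f g e = refl
  sumBelow-ext (suc m) f g e = cong₂ _+_ (e m) (sumBelow-ext m f g e)

  sumBelow-* : ∀ m k f → sumBelow m (λ d → k * f d) ≡ k * sumBelow m f
  sumBelow-* zero k f = sym (NP.*-zeroʳ k)
  sumBelow-* (suc m) k f = trans (cong (k * f m +_) (sumBelow-* m k f)) (sym (NP.*-distribˡ-+ k (f m) _))

  ≤ᵇ-suc : ∀ m n → (suc m ≤ᵇ suc n) ≡ (m ≤ᵇ n)
  ≤ᵇ-suc zero n = refl
  ≤ᵇ-suc (suc m) n = refl

  -- Comparing the identities for n + 2 and n gives S(n+2) + q^{n+1} = q^{n+2}.
  layerSize-shift : ∀ n d → layerSize (suc (suc n)) (suc d) ≡ q * layerSize n d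
  layerSize-shift n d rewrite NP.+-suc d d | ≤ᵇ-suc (suc (d + d)) (suc n) | ≤ᵇ-suc (d + d) n with d + d ≤ᵇ n
  ... | true = NP.*-assoc q (q ^ d) _
  ... | false = sym (NP.*-zeroʳ q)

  layerSize-top : ∀ n → layerSize n (suc n) ≡ 0
  layerSize-top n with suc n + suc n ≤ᵇ n in e
  ... | false = refl
  ... | true = ⊥-elim (NP.<-irrefl refl (NP.≤-trans (s≤s (NP.m≤m+n n (suc n))) (≤ᵇ≡true⇒≤ e)))

  layerSum-rec : ∀ n → layerSum (suc (suc n)) ≡ sqfCount (suc (suc n)) + q * layerSum n
  layerSum-rec n = trans (sumBelow-shift (suc (suc n)) (layerSize (suc (suc n))))
    (cong₂ _+_ (NP.+-identityʳ _) (trans (sumBelow-ext (suc (suc n)) _ _ (layerSize-shift n)) (trans (sumBelow-* (suc (suc n)) q (layerSize n))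
      (cong (q *_) (cong (_+ layerSum n) (layerSize-top n))))))

  sqfCount-1 : sqfCount 1 ≡ q
  sqfCount-1 = trans (sym (NP.+-identityʳ (sqfCount 1))) (trans (sym (NP.+-identityʳ _)) (trans (sym (monics-by-squarePart 1)) (NP.*-identityʳ q)))

  sqfCount-rec : ∀ n → sqfCount (suc (suc n)) + q ^ suc n ≡ q ^ suc (suc n)
  sqfCount-rec n = trans (cong (sqfCount (suc (suc n)) +_) (cong (q *_) (monics-by-squarePart n))) (trans (sym (layerSum-rec n)) (sym (monics-by-squarePart (suc (suc n)))))

  -- Initial values and recurrences for A and B (B_c does not depend on c ≠ 0).
  eval-one≢0 : ∀ c → eval (monic []ᵥ) c ≢ 0#
  eval-one≢0 c e = 1≢0 (trans (sym (eval-one c)) e)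

  𝒴Count-0 : 𝒴Count 0 ≡ 1
  𝒴Count-0 rewrite ⇒notRoot []ᵥ 0# (eval-one≢0 0#) = refl

  avoidCount-0 : ∀ c → avoidCount c 0 ≡ 1
  avoidCount-0 c rewrite ⇒notRoot []ᵥ 0# (eval-one≢0 0#) | ⇒notRoot []ᵥ c (eval-one≢0 c) = refl

  𝒴Count-rec : ∀ m → 𝒴Count (suc m) + 𝒴Count m ≡ sqfCount (suc m)
  𝒴Count-rec m = sym (sqfCount-split m)

  avoidCount-indep : ∀ a → a ≢ 0# → ∀ m → avoidCount a m ≡ avoidCount 1# m
  avoidCount-indep a a0 zero = trans (avoidCount-0 a) (sym (avoidCount-0 1#))
  avoidCount-indep a a0 (suc m) = NP.+-cancelʳ-≡ _ _ _ (trans (cong (avoidCount a (suc m) +_) (sym (avoidCount-indep a a0 m)))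
    (trans (sym (𝒴Count-split a a0 m)) (𝒴Count-split 1# 1≢0 m)))

  avoidCount₁ : ℕ → ℕ
  avoidCount₁ = avoidCount 1#

  avoidCount₁-0 : avoidCount₁ 0 ≡ 1
  avoidCount₁-0 = avoidCount-0 1#

  avoidCount₁-rec : ∀ m → avoidCount₁ (suc m) + avoidCount₁ m ≡ 𝒴Count (suc m)
  avoidCount₁-rec m = sym (𝒴Count-split 1# 1≢0 m)

  -- Back to the notions of Defs: |𝒴_n| = A(n), and the total number of linear factors
  -- is Σ_a #{f ∈ 𝒴_n : (T - a) ∣ f} = (q - 1) · B(m) for n = m + 1 (double counting).
  card𝒴≡ : ∀ n → D.card𝒴 K n ≡ 𝒴Count n
  card𝒴≡ n = cong length (filter-ext _ _ (monics n) (λ f → cong (isSquarefree f ∧_) (nonzeroConst≡ f)))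

  linearDivides′ : F → ∀ {n} → Vec F n → Bool
  linearDivides′ a f = D.linearDivides K a f

  X₁+Y₁≡ : ∀ {n} (f : Vec F n) → D.X₁ K f + D.Y₁ K f ≡ length (filterᵇ (λ a → linearDivides′ a f) elems)
  X₁+Y₁≡ f = sym (trans (filter-split (λ a → linearDivides′ a f) (D.isSquare K) elems)
    (cong₂ _+_ (cong length (filter-ext _ _ elems (λ a → BP.∧-comm (linearDivides′ a f) (D.isSquare K a))))
               (cong length (filter-ext _ _ elems (λ a → BP.∧-comm (linearDivides′ a f) (not (D.isSquare K a)))))))

  isNonzero : F → Bool
  isNonzero a = not (does (a ≟ 0#))

  totalLinear≡ : ∀ n → D.totalLinear K n ≡ sum (map (λ a → rootCount a n) elems)
  totalLinear≡ n = trans (cong sum (map-cong X₁+Y₁≡ (D.𝒴 K n))) (double-count (λ f a → linearDivides′ a f) (D.𝒴 K n) elems)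

  sum-rootCount : ∀ m xs → sum (map (λ a → rootCount a (suc m)) xs) ≡ length (filterᵇ isNonzero xs) * avoidCount₁ m
  sum-rootCount m [] = refl
  sum-rootCount m (a ∷ xs) with a ≟ 0#
  ... | yes refl = trans (cong (_+ sum (map (λ a → rootCount a (suc m)) xs)) (rootCount-zero (suc m))) (sum-rootCount m xs)
  ... | no a≢0 = cong₂ _+_ (trans (rootCount-nonzero a a≢0 m) (avoidCount-indep a a≢0 m)) (sum-rootCount m xs)

  zeroCount : length (filterᵇ (λ a → does (a ≟ 0#)) elems) ≡ 1
  zeroCount = unique-≋⇒length≡ (Unique-filterᵇ _ elems-unique) u1 forward backward
    where
    u1 : Unique (0# ∷ [])
    u1 = [] ∷ []
    forward : ∀ {z} → z ∈ filterᵇ (λ a → does (a ≟ 0#)) elems → z ∈ 0# ∷ []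
    forward {z} z∈ with z ≟ 0# | proj₂ (∈-filterᵇ⁻ (λ a → does (a ≟ 0#)) elems z∈)
    ... | yes p | _ = here p
    backward : ∀ {z} → z ∈ 0# ∷ [] → z ∈ filterᵇ (λ a → does (a ≟ 0#)) elems
    backward (here refl) = ∈-filterᵇ⁺ _ elems (elems-complete 0#) dz
      where
      dz : does (0# ≟ 0#) ≡ true
      dz with 0# ≟ 0#
      ... | yes _ = refl
      ... | no n = ⊥-elim (n refl)

  nonzeroCount : length (filterᵇ isNonzero elems) + 1 ≡ q
  nonzeroCount = trans (NP.+-comm _ 1) (trans (cong (_+ length (filterᵇ isNonzero elems)) (sym zeroCount))
    (trans (sym (filter-split (λ _ → true) (λ a → does (a ≟ 0#)) elems)) (cong length (filter-all elems))))

  nonzeroCount≥1 : 1 ≤ length (filterᵇ isNonzero elems)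
  nonzeroCount≥1 = nonempty (filterᵇ isNonzero elems) (∈-filterᵇ⁺ isNonzero elems (elems-complete 1#) 1-nonzero)
    where
    1-nonzero : isNonzero 1# ≡ true
    1-nonzero with 1# ≟ 0#
    ... | yes e = ⊥-elim (1≢0 e)
    ... | no _ = refl
    nonempty : ∀ (xs : List F) {x} → x ∈ xs → 1 ≤ length xs
    nonempty (_ ∷ _) _ = s≤s z≤n

  totalLinear-suc : ∀ m → D.totalLinear K (suc m) ≡ length (filterᵇ isNonzero elems) * avoidCount₁ m
  totalLinear-suc m = trans (totalLinear≡ (suc m)) (sum-rootCount m elems)

-- Exponentials beat linear functions: for n past an explicit threshold
-- depending on K, we have K·n + 2 ≤ 2ⁿ.  This gives the effective N in the
-- convergence statement.
module LinearVsExponential where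
  open import Data.Nat using (_+_; _*_; _^_; _∸_)
  import Data.Nat.Tactic.RingSolver as NS

  n<2^n : ∀ n → suc n ≤ 2 ^ n
  n<2^n zero = s≤s z≤n
  n<2^n (suc n) = NP.≤-trans (s≤s (NP.m≤n+m (suc n) n))
    (NP.≤-trans (NP.≤-reflexive (cong (suc n +_) (sym (NP.+-identityʳ (suc n))))) (NP.*-mono-≤ (NP.≤-refl {2}) (n<2^n n)))

  threshold : ℕ → ℕ
  threshold K = (2 + 2 * K) + (2 + 2 * K)

  -- At the threshold itself: write it as b + b and use (b+1)² ≤ 2ᵇ·2ᵇ.
  linear≤2^-base : ∀ K → K * threshold K + 2 ≤ 2 ^ threshold K
  linear≤2^-base K = NP.≤-trans square-bound
    (NP.≤-trans (NP.*-mono-≤ (n<2^n b) (n<2^n b)) (NP.≤-reflexive (sym (NP.^-distribˡ-+-* 2 b b))))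
    where
    b = 2 + 2 * K
    expand : ∀ K → K * ((2 + 2 * K) + (2 + 2 * K)) + 2 + (8 * K + 7) ≡ suc (2 + 2 * K) * suc (2 + 2 * K)
    expand = NS.solve-∀
    square-bound : K * (b + b) + 2 ≤ suc b * suc b
    square-bound = NP.≤-trans (NP.m≤m+n _ (8 * K + 7)) (NP.≤-reflexive (expand K))

  -- Beyond the threshold each step adds K on the left and doubles the right.
  linear≤2^-above : ∀ K d → K * (threshold K + d) + 2 ≤ 2 ^ (threshold K + d)
  linear≤2^-above K zero = subst (λ n → K * n + 2 ≤ 2 ^ n) (sym (NP.+-identityʳ _)) (linear≤2^-base K)
  linear≤2^-above K (suc d) = subst (λ n → K * n + 2 ≤ 2 ^ n) (sym (NP.+-suc (threshold K) d)) step
    where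
    n = threshold K + d
    ih : K * n + 2 ≤ 2 ^ n
    ih = linear≤2^-above K d
    K≤2^n : K ≤ 2 ^ n
    K≤2^n = NP.≤-trans (NP.m≤m*n K (suc (1 + 2 * K + (2 + 2 * K) + d))) (NP.≤-trans (NP.m≤m+n _ 2) ih)
    regroup : ∀ K n → K * suc n + 2 ≡ (K * n + 2) + K
    regroup = NS.solve-∀
    step : K * suc n + 2 ≤ 2 ^ suc n
    step = NP.≤-trans (NP.≤-reflexive (regroup K n))
      (NP.≤-trans (NP.+-mono-≤ ih K≤2^n) (NP.≤-reflexive (cong (2 ^ n +_) (sym (NP.+-identityʳ (2 ^ n))))))

  linear≤2^ : ∀ K n → threshold K ≤ n → K * n + 2 ≤ 2 ^ n
  linear≤2^ K n le = subst (λ n → K * n + 2 ≤ 2 ^ n) (NP.m+[n∸m]≡n le) (linear≤2^-above K (n ∸ threshold K))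

-- Solving the recurrences over
-- ℤ gives, with σ = -1,
--   (q+1)·A(m+1) = (q-1)(q^{m+1} - σ^{m+1}),
--   (q+1)·T(m+1) - (q-1)·A(m+1) = (q-1)·σ^{m+1}·(q·m - (m+2)),
-- so the relative error of T/A against (q-1)/(q+1) is O(m/q^m).
module Asymptotics (q₀ : ℕ) (q₀≥1 : 1 ≤ q₀) (S A B T : ℕ → ℕ)
  (S-1 : S 1 ≡ suc q₀) (S-rec : ∀ n → S (suc (suc n)) Nt.+ suc q₀ Nt.^ suc n ≡ suc q₀ Nt.^ suc (suc n))
  (A-0 : A 0 ≡ 1) (A-rec : ∀ m → A (suc m) Nt.+ A m ≡ S (suc m))
  (B-0 : B 0 ≡ 1) (B-rec : ∀ m → B (suc m) Nt.+ B m ≡ A (suc m))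
  (T-rec : ∀ m → T (suc m) ≡ q₀ Nt.* B m) where
  import Data.Nat as N
  open import Data.Integer using (ℤ; +_; _+_; _*_; _-_; -_; _^_; 1ℤ; 0ℤ; ∣_∣; _⊖_)
  import Data.Integer.Properties as ZP
  open import Data.Integer.Tactic.RingSolver using (solve-∀)
  import Data.Nat.Tactic.RingSolver as NS
  open Eq.≡-Reasoning
  open LinearVsExponential using (threshold; linear≤2^)

  q : ℕ
  q = suc q₀

  Q Q₀ σ : ℤ
  Q = + q
  Q₀ = + q₀
  σ = - 1ℤ

  q≥2 : 2 ≤ q
  q≥2 = s≤s q₀≥1

  pos-^ : ∀ n → + (q N.^ n) ≡ Q ^ n
  pos-^ zero = refl
  pos-^ (suc n) = trans (ZP.pos-* q (q N.^ n)) (cong (Q *_) (pos-^ n))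

  pos-minus : ∀ x y z → x N.+ y ≡ z → + x ≡ + z - + y
  pos-minus x y z e = trans (cancel (+ x) (+ y)) (cong (_- + y) (trans (sym (ZP.pos-+ x y)) (cong +_ e)))
    where
    cancel : ∀ a b → a ≡ (a + b) - b
    cancel = solve-∀

  -- A(1) = q - 1, from A(0) = 1 and S(1) = q.
  A-1 : A 1 ≡ q₀
  A-1 = NP.+-cancelʳ-≡ 1 (A 1) q₀ (trans (cong (A 1 N.+_) (sym A-0)) (trans (A-rec 0) (trans S-1 (NP.+-comm 1 q₀))))

  -- The two recurrences for A and S combined: A(m+2) = (q^{m+2} - q^{m+1}) - A(m+1).
  A-step : ∀ m → + A (suc (suc m)) ≡ (Q * Q ^ suc m - Q ^ suc m) - + A (suc m)
  A-step m = trans (pos-minus _ _ _ (A-rec (suc m)))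
    (cong (_- + A (suc m)) (trans (pos-minus _ _ _ (S-rec m)) (cong₂ _-_ (pos-^ (suc (suc m))) (pos-^ (suc m)))))

  A-closed : ∀ m → (Q + 1ℤ) * + A (suc m) ≡ Q₀ * (Q ^ suc m - σ ^ suc m)
  A-closed zero rewrite A-1 = base Q₀
    where
    base : ∀ N → ((1ℤ + N) + 1ℤ) * N ≡ N * ((1ℤ + N) * 1ℤ - (- 1ℤ) * 1ℤ)
    base = solve-∀
  A-closed (suc m) = begin
    (Q + 1ℤ) * + A (suc (suc m))              ≡⟨ cong ((Q + 1ℤ) *_) (A-step m) ⟩
    (Q + 1ℤ) * ((Q * X - X) - a)               ≡⟨ distrib Q X a ⟩
    (Q + 1ℤ) * (Q * X - X) - (Q + 1ℤ) * a      ≡⟨ cong (λ t → (Q + 1ℤ) * (Q * X - X) - t) (A-closed m) ⟩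
    (Q + 1ℤ) * (Q * X - X) - Q₀ * (X - Y)      ≡⟨ collect Q₀ X Y ⟩
    Q₀ * (Q * X - σ * Y)                       ∎
    where
    X = Q ^ suc m
    Y = σ ^ suc m
    a = + A (suc m)
    distrib : ∀ Q X a → (Q + 1ℤ) * ((Q * X - X) - a) ≡ (Q + 1ℤ) * (Q * X - X) - (Q + 1ℤ) * a
    distrib = solve-∀
    collect : ∀ N X Y → ((1ℤ + N) + 1ℤ) * ((1ℤ + N) * X - X) - N * (X - Y) ≡ N * ((1ℤ + N) * X - (- 1ℤ) * Y)
    collect = solve-∀

  T-1 : T 1 ≡ q₀
  T-1 = trans (T-rec 0) (trans (cong (q₀ N.*_) B-0) (NP.*-identityʳ q₀))

  -- T(m+2) + T(m+1) = (q-1)·A(m+1), from T = (q-1)·B and the recurrence for B.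
  T-rec₂ : ∀ m → T (suc (suc m)) N.+ T (suc m) ≡ q₀ N.* A (suc m)
  T-rec₂ m = trans (cong₂ N._+_ (T-rec (suc m)) (T-rec m))
    (trans (sym (NP.*-distribˡ-+ q₀ (B (suc m)) (B m))) (cong (q₀ N.*_) (B-rec m)))

  -- (q+1)·T(m+1) - (q-1)·A(m+1): the numerator of T/A - (q-1)/(q+1).
  discrepancy : ℕ → ℤ
  discrepancy m = (Q + 1ℤ) * + T (suc m) - Q₀ * + A (suc m)

  discrepancy-closed : ∀ m → discrepancy m ≡ Q₀ * σ ^ suc m * (Q * + m - (+ 2 + + m))
  discrepancy-closed zero rewrite T-1 | A-1 = base Q₀
    where
    base : ∀ N → ((1ℤ + N) + 1ℤ) * N - N * N ≡ N * ((- 1ℤ) * 1ℤ) * ((1ℤ + N) * 0ℤ - (+ 2 + 0ℤ))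
    base = solve-∀
  discrepancy-closed (suc m) = begin
    (Q + 1ℤ) * t₂ - Q₀ * a₂                                              ≡⟨ cong₂ (λ u v → (Q + 1ℤ) * u - Q₀ * v) T-step (A-step m) ⟩
    (Q + 1ℤ) * (Q₀ * a₁ - t₁) - Q₀ * ((Q * X - X) - a₁)                  ≡⟨ regroup Q Q₀ a₁ t₁ X ⟩
    Q₀ * ((Q + 1ℤ) * a₁) - ((Q + 1ℤ) * t₁ - Q₀ * a₁) - Q₀ * (Q * X - X)  ≡⟨ cong₂ (λ u v → Q₀ * u - v - Q₀ * (Q * X - X)) (A-closed m) (discrepancy-closed m) ⟩
    Q₀ * (Q₀ * (X - Y)) - Q₀ * Y * (Q * + m - (+ 2 + + m)) - Q₀ * (Q * X - X) ≡⟨ collect Q₀ X Y (+ m) ⟩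
    Q₀ * (σ * Y) * (Q * (1ℤ + + m) - (+ 3 + + m))                        ∎
    where
    X = Q ^ suc m
    Y = σ ^ suc m
    a₁ = + A (suc m)
    a₂ = + A (suc (suc m))
    t₁ = + T (suc m)
    t₂ = + T (suc (suc m))
    T-step : t₂ ≡ Q₀ * a₁ - t₁
    T-step = trans (pos-minus _ _ _ (T-rec₂ m)) (cong (_- t₁) (ZP.pos-* q₀ (A (suc m))))
    regroup : ∀ Q N a t X → (Q + 1ℤ) * (N * a - t) - N * ((Q * X - X) - a) ≡ N * ((Q + 1ℤ) * a) - ((Q + 1ℤ) * t - N * a) - N * (Q * X - X)
    regroup = solve-∀
    collect : ∀ N X Y M → N * (N * (X - Y)) - N * Y * ((1ℤ + N) * M - (+ 2 + M)) - N * ((1ℤ + N) * X - X) ≡ N * ((- 1ℤ) * Y) * ((1ℤ + N) * (1ℤ + M) - (+ 3 + M))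
    collect = solve-∀

  ∣σ^k∣≡1 : ∀ k → ∣ σ ^ k ∣ ≡ 1
  ∣σ^k∣≡1 zero = refl
  ∣σ^k∣≡1 (suc k) = trans (ZP.abs-* σ (σ ^ k)) (cong (1 N.*_) (∣σ^k∣≡1 k))

  σ^k≡±1 : ∀ k → σ ^ k ≡ 1ℤ ⊎ σ ^ k ≡ - 1ℤ
  σ^k≡±1 zero = inj₁ refl
  σ^k≡±1 (suc k) with σ^k≡±1 k
  ... | inj₁ p = inj₂ (cong (σ *_) p)
  ... | inj₂ p = inj₁ (cong (σ *_) p)

  ∣qm-[2+m]∣≤ : ∀ m → ∣ Q * + m - (+ 2 + + m) ∣ N.≤ q N.* suc m
  ∣qm-[2+m]∣≤ m = subst (λ z → ∣ z ∣ N.≤ q N.* suc m) (sym as-⊖)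
    (NP.≤-trans (ZP.∣m⊝n∣≤m⊔n (q N.* m) (2 N.+ m)) (NP.⊔-lub (NP.*-mono-≤ (NP.≤-refl {q}) (NP.n≤1+n m)) 2+m≤))
    where
    as-⊖ : Q * + m - (+ 2 + + m) ≡ (q N.* m) ⊖ (2 N.+ m)
    as-⊖ = trans (cong (_- (+ 2 + + m)) (sym (ZP.pos-* q m))) (ZP.m-n≡m⊖n (q N.* m) (2 N.+ m))
    2+m≤ : 2 N.+ m N.≤ q N.* suc m
    2+m≤ = NP.≤-trans (s≤s (NP.≤-trans (NP.m≤n+m (suc m) m) (NP.≤-reflexive (cong (m N.+_) (sym (NP.+-identityʳ (suc m)))))))
                      (NP.*-mono-≤ q≥2 (NP.≤-refl {suc m}))

  discrepancy-bound : ∀ m → ∣ discrepancy m ∣ N.≤ q₀ N.* (q N.* suc m)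
  discrepancy-bound m = NP.≤-trans (NP.≤-reflexive abs-closed) (NP.*-mono-≤ (NP.≤-refl {q₀}) (∣qm-[2+m]∣≤ m))
    where
    abs-closed : ∣ discrepancy m ∣ ≡ q₀ N.* ∣ Q * + m - (+ 2 + + m) ∣
    abs-closed = trans (cong ∣_∣ (discrepancy-closed m)) (trans (ZP.abs-* (Q₀ * σ ^ suc m) _)
      (cong (N._* ∣ Q * + m - (+ 2 + + m) ∣)
        (trans (ZP.abs-* Q₀ (σ ^ suc m)) (trans (cong (q₀ N.*_) (∣σ^k∣≡1 (suc m))) (NP.*-identityʳ q₀)))))

  A-lower : ∀ m → q₀ N.* q N.^ suc m N.≤ (q N.+ 1) N.* A (suc m) N.+ q₀
  A-lower m with σ^k≡±1 (suc m)
  ... | inj₁ p = NP.≤-reflexive (sym (cong ∣_∣ as-ℤ))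
    where
    X = Q ^ suc m
    shift : ∀ N X → N * (X - 1ℤ) + N ≡ N * X
    shift = solve-∀
    as-ℤ : + ((q N.+ 1) N.* A (suc m) N.+ q₀) ≡ + (q₀ N.* q N.^ suc m)
    as-ℤ = begin
      + ((q N.+ 1) N.* A (suc m) N.+ q₀) ≡⟨ ZP.pos-+ _ q₀ ⟩
      + ((q N.+ 1) N.* A (suc m)) + Q₀   ≡⟨ cong (_+ Q₀) (ZP.pos-* (q N.+ 1) (A (suc m))) ⟩
      (Q + 1ℤ) * + A (suc m) + Q₀        ≡⟨ cong (_+ Q₀) (trans (A-closed m) (cong (λ t → Q₀ * (X - t)) p)) ⟩
      Q₀ * (X - 1ℤ) + Q₀                 ≡⟨ shift Q₀ X ⟩
      Q₀ * X                             ≡⟨ cong (Q₀ *_) (sym (pos-^ (suc m))) ⟩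
      Q₀ * + (q N.^ suc m)               ≡⟨ sym (ZP.pos-* q₀ _) ⟩
      + (q₀ N.* q N.^ suc m)             ∎
  ... | inj₂ p = NP.≤-trans (NP.m≤m+n (q₀ N.* q N.^ suc m) q₀) (NP.≤-trans (NP.≤-reflexive (sym (cong ∣_∣ as-ℤ))) (NP.m≤m+n _ q₀))
    where
    X = Q ^ suc m
    shift : ∀ N X → N * (X - (- 1ℤ)) ≡ N * X + N
    shift = solve-∀
    as-ℤ : + ((q N.+ 1) N.* A (suc m)) ≡ + (q₀ N.* q N.^ suc m N.+ q₀)
    as-ℤ = begin
      + ((q N.+ 1) N.* A (suc m))  ≡⟨ ZP.pos-* (q N.+ 1) (A (suc m)) ⟩
      (Q + 1ℤ) * + A (suc m)       ≡⟨ trans (A-closed m) (cong (λ t → Q₀ * (X - t)) p) ⟩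
      Q₀ * (X - (- 1ℤ))            ≡⟨ shift Q₀ X ⟩
      Q₀ * X + Q₀                  ≡⟨ cong (λ t → Q₀ * t + Q₀) (sym (pos-^ (suc m))) ⟩
      Q₀ * + (q N.^ suc m) + Q₀    ≡⟨ cong (_+ Q₀) (sym (ZP.pos-* q₀ _)) ⟩
      + (q₀ N.* q N.^ suc m) + Q₀  ≡⟨ sym (ZP.pos-+ _ q₀) ⟩
      + (q₀ N.* q N.^ suc m N.+ q₀) ∎

  A-positive : ∀ m → 1 ≤ A (suc m)
  A-positive m with A (suc m) | A-lower m
  ... | suc a | _ = s≤s z≤n
  ... | zero | lower = ⊥-elim (NP.<-irrefl refl (NP.≤-trans q₀<q₀q^ (NP.≤-trans lower (NP.≤-reflexive (cong (N._+ q₀) (NP.*-zeroʳ (q N.+ 1)))))))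
    where
    double : ∀ a → a N.* 2 ≡ a N.+ a
    double = NS.solve-∀
    2≤q^ : 2 ≤ q N.^ suc m
    2≤q^ = NP.≤-trans q≥2 (NP.m≤m*n q (q N.^ m) {{NP.m^n≢0 q m}})
    q₀<q₀q^ : suc q₀ N.≤ q₀ N.* q N.^ suc m
    q₀<q₀q^ = NP.≤-trans (NP.≤-trans (NP.≤-reflexive (NP.+-comm 1 q₀)) (NP.+-monoʳ-≤ q₀ q₀≥1))
                        (NP.≤-trans (NP.≤-reflexive (sym (double q₀))) (NP.*-mono-≤ (NP.≤-refl {q₀}) 2≤q^))

  relative-error : ∀ m den num → 1 ≤ num → threshold (q N.* den) ≤ suc m →
    ∣ discrepancy m ∣ N.* den N.< num N.* ((q N.+ 1) N.* A (suc m))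
  relative-error m den num num≥1 le =
    NP.<-≤-trans (NP.≤-<-trans scaled-bound discrepancy<) at-least-once
    where
    K = q N.* den
    n = suc m
    at-least-once : (q N.+ 1) N.* A n N.≤ num N.* ((q N.+ 1) N.* A n)
    at-least-once = NP.≤-trans (NP.≤-reflexive (sym (NP.*-identityˡ _))) (NP.*-mono-≤ num≥1 NP.≤-refl)
    rearrange : ∀ a b c d → a N.* (b N.* c) N.* d ≡ a N.* ((b N.* d) N.* c)
    rearrange = NS.solve-∀
    scaled-bound : ∣ discrepancy m ∣ N.* den N.≤ q₀ N.* (K N.* n)
    scaled-bound = NP.≤-trans (NP.*-mono-≤ (discrepancy-bound m) (NP.≤-refl {den})) (NP.≤-reflexive (rearrange q₀ q n den))
    K·n+2≤q^n : K N.* n N.+ 2 N.≤ q N.^ n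
    K·n+2≤q^n = NP.≤-trans (linear≤2^ K n le) (NP.^-monoˡ-≤ n q≥2)
    factor-out : ∀ a b → a N.* b N.+ a N.+ a ≡ a N.* (b N.+ 2)
    factor-out = NS.solve-∀
    with-slack : q₀ N.* (K N.* n) N.+ q₀ N.≤ (q N.+ 1) N.* A n
    with-slack = NP.+-cancelʳ-≤ q₀ _ _
      (NP.≤-trans (NP.≤-reflexive (factor-out q₀ (K N.* n))) (NP.≤-trans (NP.*-mono-≤ (NP.≤-refl {q₀}) K·n+2≤q^n) (A-lower m)))
    discrepancy< : q₀ N.* (K N.* n) N.< (q N.+ 1) N.* A n
    discrepancy< = NP.<-≤-trans (NP.≤-<-trans (NP.≤-reflexive (sym (NP.+-identityʳ _))) (NP.+-monoʳ-< (q₀ N.* (K N.* n)) q₀≥1)) with-slack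

module RationalBound where
  open import Data.Nat as N using (NonZero)
  open import Data.Integer as Z using (ℤ; +_; -[1+_]; +[1+_]; ∣_∣) renaming (_+_ to _+ᶻ_; _*_ to _*ᶻ_; _-_ to _-ᶻ_; -_ to -ᶻ_)
  import Data.Integer.Properties as ZP
  open import Data.Rational as Q using (ℚ; mkℚ; _/_; 0ℚ; toℚᵘ; fromℚᵘ) renaming (∣_∣ to ∣_∣ℚ; _<_ to _<ℚ_; _-_ to _-ℚ_)
  import Data.Rational.Properties as QP
  open import Data.Rational.Unnormalised as U using (mkℚᵘ; *<*) renaming (_<_ to _<ᵘ_; _≃_ to _≃ᵘ_)
  import Data.Rational.Unnormalised.Properties as ℚᵘP
  open import Data.Nat.Coprimality using (Coprime)

  -- The numerator t·(q+1) - (q-1)·c of t/c - (q-1)/(q+1).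
  numerator : ℕ → ℕ → ℕ → ℤ
  numerator t c q = + t *ᶻ + suc q +ᶻ (-ᶻ (+ q -ᶻ + 1)) *ᶻ + c

  -- The comparison for ε = (1+k)/(1+d), carried out in ℚᵘ where it is a
  -- cross-multiplication of integers.
  close-to-mkℚ : ∀ (t c q k d : ℕ) .{{_ : NonZero c}} .(cop : Coprime (suc k) (suc d)) →
    ∣ numerator t c q ∣ N.* suc d N.< suc k N.* (c N.* suc q) →
    ∣ ((+ t) / c) -ℚ ((+ q -ᶻ + 1) / suc q) ∣ℚ <ℚ mkℚ (+ suc k) d cop
  close-to-mkℚ t (suc c') q k d cop ineq = QP.toℚᵘ-cancel-< (ℚᵘP.<-respˡ-≃ (ℚᵘP.≃-sym to-unnormalised) core)
    where
    u = mkℚᵘ (+ t) c'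
    v = mkℚᵘ (+ q -ᶻ + 1) q
    x = fromℚᵘ u
    y = fromℚᵘ v
    to-unnormalised : toℚᵘ (∣ x -ℚ y ∣ℚ) ≃ᵘ U.∣ u U.- v ∣
    to-unnormalised = ℚᵘP.≃-trans (QP.toℚᵘ-homo-∣-∣ (x -ℚ y))
      (ℚᵘP.∣-∣-cong (ℚᵘP.≃-trans (QP.toℚᵘ-homo-+ x (Q.- y))
        (ℚᵘP.+-cong (QP.toℚᵘ-fromℚᵘ u) (ℚᵘP.≃-trans (QP.toℚᵘ-homo‿- y) (ℚᵘP.-‿cong (QP.toℚᵘ-fromℚᵘ v))))))
    core : U.∣ u U.- v ∣ <ᵘ toℚᵘ (mkℚ (+ suc k) d cop)
    core = *<* (subst₂ Z._<_ (ZP.pos-* ∣ numerator t (suc c') q ∣ (suc d)) (ZP.pos-* (suc k) (suc c' N.* suc q)) (Z.+<+ ineq))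
      where open Eq using (subst₂)

  numerator-positive : ∀ ε → 0ℚ <ℚ ε → 1 N.≤ ∣ Q.↥ ε ∣
  numerator-positive (mkℚ +[1+ k ] d _) _ = N.s≤s N.z≤n
  numerator-positive (mkℚ (+ 0) d _) (Q.*<* (Z.+<+ ()))
  numerator-positive (mkℚ -[1+ n ] d _) (Q.*<* ())

  close-to : ∀ (t c q : ℕ) .{{_ : NonZero c}} (ε : ℚ) → 0ℚ <ℚ ε →
    ∣ numerator t c q ∣ N.* Q.↧ₙ ε N.< ∣ Q.↥ ε ∣ N.* (c N.* suc q) →
    ∣ ((+ t) / c) -ℚ ((+ q -ᶻ + 1) / suc q) ∣ℚ <ℚ ε
  close-to t c q (mkℚ +[1+ k ] d cop) _ = close-to-mkℚ t c q k d cop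
  close-to t c q (mkℚ (+ 0) d _) (Q.*<* (Z.+<+ ()))
  close-to t c q (mkℚ -[1+ n ] d _) (Q.*<* ())

module MeanLinearFactors (K : FiniteField) where
  import Data.Nat as N
  open import Data.Nat using (NonZero)
  open import Data.Integer as Z using (+_)
  open import Data.Integer.Tactic.RingSolver using (solve-∀)
  open Counting K
  open LinearVsExponential using (threshold)
  open RationalBound using (numerator)

  q₀ : ℕ
  q₀ = length (filterᵇ isNonzero (FiniteField.elems K))

  order≡ : D.order K ≡ suc q₀
  order≡ = trans (sym nonzeroCount) (NP.+-comm q₀ 1)

  module Asym = Asymptotics q₀ nonzeroCount≥1 sqfCount 𝒴Count avoidCount₁ (D.totalLinear K)
    (trans sqfCount-1 order≡)
    (λ n → subst (λ q → sqfCount (suc (suc n)) N.+ q N.^ suc n ≡ q N.^ suc (suc n)) order≡ (sqfCount-rec n))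
    𝒴Count-0 𝒴Count-rec avoidCount₁-0 avoidCount₁-rec totalLinear-suc

  card𝒴-nonZero : ∀ m → NonZero (D.card𝒴 K (suc m))
  card𝒴-nonZero m = N.>-nonZero (subst (1 ≤_) (sym (card𝒴≡ (suc m))) (Asym.A-positive m))

  numerator≡discrepancy : ∀ t a → numerator t a (suc q₀) ≡ (Asym.Q Z.+ Z.1ℤ) Z.* + t Z.- Asym.Q₀ Z.* + a
  numerator≡discrepancy t a = regroup (+ q₀) (+ t) (+ a)
    where
    regroup : ∀ N t a → t Z.* (Z.1ℤ Z.+ (Z.1ℤ Z.+ N)) Z.+ (Z.- ((Z.1ℤ Z.+ N) Z.- Z.1ℤ)) Z.* a ≡ ((Z.1ℤ Z.+ N) Z.+ Z.1ℤ) Z.* t Z.- N Z.* a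
    regroup = solve-∀

  -- The relative error bound, restated with c = A(m+1) and q = suc q₀ as variables
  -- so that card𝒴 and order can be substituted for them.
  mean-close′ : ∀ m den num → 1 ≤ num → (c q : ℕ) → c ≡ 𝒴Count (suc m) → q ≡ suc q₀ → threshold (q N.* den) ≤ suc m →
    Z.∣ numerator (D.totalLinear K (suc m)) c q ∣ N.* den N.< num N.* (c N.* suc q)
  mean-close′ m den num num≥1 .(𝒴Count (suc m)) .(suc q₀) refl refl le =
    subst₂ N._<_ (cong (λ z → Z.∣ z ∣ N.* den) (sym (numerator≡discrepancy (D.totalLinear K (suc m)) (𝒴Count (suc m)))))
                 (cong (num N.*_) (trans (NP.*-comm (suc q₀ N.+ 1) _) (cong (𝒴Count (suc m) N.*_) (NP.+-comm (suc q₀) 1))))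
                 (Asym.relative-error m den num num≥1 le)
    where open Eq using (subst₂)

  mean-close : ∀ m den num → 1 ≤ num → threshold (D.order K N.* den) ≤ suc m →
    Z.∣ numerator (D.totalLinear K (suc m)) (D.card𝒴 K (suc m)) (D.order K) ∣ N.* den N.< num N.* (D.card𝒴 K (suc m) N.* suc (D.order K))
  mean-close m den num num≥1 =
    mean-close′ m den num num≥1 (D.card𝒴 K (suc m)) (D.order K) (card𝒴≡ (suc m)) order≡

open import Defs
open import Data.Nat using (ℕ; zero; suc; _*_; _≤_; _^_; NonZero)
open import Data.Nat.Primality using (Prime)
open import Data.Integer using (+_; _-_) renaming (∣_∣ to ∣_∣ᶻ)
open import Data.Rational using (ℚ; _/_; ∣_∣; _<_; 0ℚ; ↥_; ↧ₙ_) renaming (_-_ to _-ℚ_)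
open LinearVsExponential using (threshold)
open RationalBound using (numerator-positive; close-to)

proposition4p17 : (K : FiniteField) →
    (∃ λ p → ∃ λ k → Prime p × p ≢ 2 × 1 ≤ k × order K ≡ p ^ k) →
    (ε : ℚ) → 0ℚ < ε →
    ∃ λ N → (n : ℕ) → N ≤ n →
    Σ (NonZero (card𝒴 K n)) λ nz →
    ∣ ((+ totalLinear K n) / card𝒴 K n) {{nz}} -ℚ ((+ order K - + 1) / suc (order K)) ∣ < ε
proposition4p17 K _ ε 0<ε = threshold (order K * ↧ₙ ε) , close
  where
  open MeanLinearFactors K using (card𝒴-nonZero; mean-close)
  close : (n : ℕ) → threshold (order K * ↧ₙ ε) ≤ n →
    Σ (NonZero (card𝒴 K n)) λ nz →
    ∣ ((+ totalLinear K n) / card𝒴 K n) {{nz}} -ℚ ((+ order K - + 1) / suc (order K)) ∣ < ε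
  close zero ()
  close (suc m) le = card𝒴-nonZero m ,
    close-to (totalLinear K (suc m)) (card𝒴 K (suc m)) (order K) {{card𝒴-nonZero m}} ε 0<ε
      (mean-close m (↧ₙ ε) ∣ ↥ ε ∣ᶻ (numerator-positive ε 0<ε) le)
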